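{- Let $T$ be a tiling of the $n$-gon $P$, with its Scott strands. (I) Let $t$ be a tile of $T$ and $e$ an edge of $t$, and let $s_1,s_2$ be the two strands crossing $e$, in opposite directions (one entering $t$ through $e$, one leaving $t$ through $e$). Follow both from $e$ into $t$ (i.e. $s_1$ forwards and $s_2$ backwards, or vice versa). Then: (a) if $t$ is a triangle, the two segments cross inside $t$ and the strands do not meet again; (b) if $t$ is a quadrilateral, the two segments leave $t$ through the edge opposite to $e$, again crossing that edge in opposite directions; (c) if $t$ has more than $4$ vertices, the two segments leave $t$ through different edges and the strands do not cross thereafter. (II) Any two strands of $T$ cross at most twice. If two strands cross twice, then (i) they both pass through a common edge $e$ of $T$, and (ii) the two crossings occur in triangular tiles lying on either side of $e$, and all tiles traversed between these two crossings are quadrilaterals.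
   Context: Let $P$ be a convex polygon with vertices $1,\dots,n$ ($n\ge3$) in clockwise order. A tiling $T$ is a (possibly empty) set of pairwise non-crossing (in their interiors) diagonals; tiles are the closures of the components of $P$ minus the diagonals. Scott strand construction: for each tile $Q$ with vertices $q_1,\dots,q_r$ in clockwise order (indices mod $r$) and each $j$, draw inside $Q$ a strand segment parallel to $[q_{j-1},q_j]$, entering $Q$ through the side $[q_j,q_{j+1}]$ near $q_j$ and leaving $Q$ through the side $[q_{j-2},q_{j-1}]$ near $q_{j-1}$; if the entering side is a boundary edge of $P$ the segment starts at vertex $q_j$, and if the leaving side is a boundary edge of $P$ it ends at vertex $q_{j-1}$. At a diagonal $d$ shared by two tiles, a segment leaving one tile through $d$ near an endpoint $v$ is continued by the segment of the other tile entering through $d$ near $v$. The resulting concatenated oriented curves are the strands. -}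

module Defs where

open import Data.Nat using (ℕ; zero; suc; _+_; _*_; _≤_; _<_)
open import Data.Nat.Properties using (_≟_)
open import Data.Bool using (if_then_else_)
open import Data.List using (List; []; _∷_; _++_; length; lookup)
open import Data.List.Membership.Propositional using (_∈_)
open import Data.List.Relation.Unary.All using (All)
open import Data.List.Relation.Unary.Any using (Any)
open import Data.List.Relation.Unary.AllPairs using (AllPairs)
open import Data.List.Relation.Unary.Linked using (Linked)
open import Data.Fin using (Fin; toℕ)
open import Data.Product using (Σ; ∃₂; _×_; _,_; proj₁; proj₂)
open import Data.Sum using (_⊎_)
open import Data.Empty using (⊥)
open import Relation.Nullary using (¬_; does)
open import Relation.Binary.PropositionalEquality using (_≡_; _≢_)

-- The n-gon P: vertices 0,1,…,n-1 in clockwise order (the paper's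
-- vertices 1,…,n, shifted by one).  Increasing index = clockwise.

IsDiagonal : ℕ → ℕ × ℕ → Set
IsDiagonal n (a , b) = (suc a < b) × (b < n) × ¬ (a ≡ 0 × suc b ≡ n)

-- Two diagonals cross in their interiors iff their endpoints interleave.
DiagCross : ℕ × ℕ → ℕ × ℕ → Set
DiagCross (a , b) (c , d) = (a < c × c < b × b < d) ⊎ (c < a × a < d × d < b)

record Tiling (n : ℕ) : Set where
  field
    diags            : List (ℕ × ℕ)
    diags-valid      : All (IsDiagonal n) diags
    diags-compatible : AllPairs (λ d e → d ≢ e × ¬ DiagCross d e) diags
open Tiling public

BoundaryEdge : ℕ → ℕ → ℕ → Set
BoundaryEdge n x y = (suc x < n × y ≡ suc x) ⊎ (suc x ≡ n × y ≡ 0)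

IsDiagOf : ∀ {n} → Tiling n → ℕ → ℕ → Set
IsDiagOf T x y = (x , y) ∈ diags T ⊎ (y , x) ∈ diags T

IsEdgeOf : ∀ {n} → Tiling n → ℕ → ℕ → Set
IsEdgeOf {n} T x y = BoundaryEdge n x y ⊎ IsDiagOf T x y

Consec : List ℕ → ℕ → ℕ → Set
Consec (a ∷ b ∷ t) x y = (a ≡ x × b ≡ y) ⊎ Consec (b ∷ t) x y
Consec _           x y = ⊥

CycSucc : List ℕ → ℕ → ℕ → Set
CycSucc []      x y = ⊥
CycSucc (h ∷ t) x y = Consec ((h ∷ t) ++ (h ∷ [])) x y

-- A tile is the closure of a component of P minus the diagonals;
-- it is the convex polygon on a set of vertices of P.  We record a tile
-- by the list of its vertices in clockwise (= increasing) order.  A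
-- vertex set q is (the vertex set of) a tile iff every side of the convex
-- polygon on q is an edge of T (boundary edge of P or diagonal of T) and
-- no diagonal of T joins two non-consecutive vertices of q.
record IsTile {n : ℕ} (T : Tiling n) (q : List ℕ) : Set where
  field
    bounded     : All (_< n) q
    increasing  : Linked _<_ q
    atLeast3    : 3 ≤ length q
    sidesEdges  : ∀ {x y} → CycSucc q x y → IsEdgeOf T x y
    noInnerDiag : ∀ {x y} → x ∈ q → y ∈ q → IsDiagOf T x y →
                  CycSucc q x y ⊎ CycSucc q y x

-- Strand segments.  For a tile Q = (q_1,…,q_r) and index j the segment
-- is determined by the side [q_{j-1}, q_j] it is parallel to; we record
-- it as (Q , u , v) with u = q_{j-1}, v = q_j.
record Seg : Set where
  constructor seg
  field
    tile : List ℕ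
    u    : ℕ
    v    : ℕ
open Seg public

IsSeg : ∀ {n} → Tiling n → Seg → Set
IsSeg T s = IsTile T (tile s) × CycSucc (tile s) (u s) (v s)

-- s enters its tile through the side [a , b] (a clockwise before b),
-- near a.  (The segment (q_{j-1}, q_j) enters through [q_j, q_{j+1}]
-- near q_j.)
EntersThrough : Seg → ℕ → ℕ → Set
EntersThrough s a b = CycSucc (tile s) a b × v s ≡ a

-- s leaves its tile through the side [a , b], near b.  (The segment
-- (q_{j-1}, q_j) leaves through [q_{j-2}, q_{j-1}] near q_{j-1}.)
LeavesThrough : Seg → ℕ → ℕ → Set
LeavesThrough s a b = CycSucc (tile s) a b × u s ≡ b

-- the entering side is a boundary edge of P: the segment starts at a vertex
StartsAtVertex : ℕ → Seg → Set
StartsAtVertex n s = ∃₂ λ a b → EntersThrough s a b × BoundaryEdge n a b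

-- the leaving side is a boundary edge of P: the segment ends at a vertex
EndsAtVertex : ℕ → Seg → Set
EndsAtVertex n s = ∃₂ λ a b → LeavesThrough s a b × BoundaryEdge n a b

Continues : ∀ {n} → Tiling n → Seg → Seg → Set
Continues T s s' =
  ∃₂ λ a b → LeavesThrough s a b × EntersThrough s' b a × IsDiagOf T a b

HeadP : {A : Set} → (A → Set) → List A → Set
HeadP P []      = ⊥
HeadP P (x ∷ _) = P x

LastP : {A : Set} → (A → Set) → List A → Set
LastP P []          = ⊥
LastP P (x ∷ [])    = P x
LastP P (_ ∷ y ∷ t) = LastP P (y ∷ t)

-- A strand: the maximal concatenation of segments, listed in the
-- direction of its orientation, starting at a vertex and ending at a
-- vertex of P.
IsStrand : ∀ {n} → Tiling n → List Seg → Set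
IsStrand {n} T ss =
  All (IsSeg T) ss × Linked (Continues T) ss ×
  HeadP (StartsAtVertex n) ss × LastP (EndsAtVertex n) ss

-- On the boundary of a tile Q = (q_0,…,q_{r-1}) (0-based
-- position in the clockwise list) put the cyclically ordered points
--   (near q_k on side [q_{k-1},q_k]) = 3k ,  q_k = 3k+1 ,
--   (near q_k on side [q_k,q_{k+1}]) = 3k+2 .
-- The segment (u , v) runs from the point near v on the side after v to
-- the point near u on the side before u.  Two segments of the same tile
-- cross iff their endpoints interleave.  (Endpoints sitting at a vertex
-- of P are treated as the nearby points.)
idxOf : List ℕ → ℕ → ℕ
idxOf []       x = 0
idxOf (y ∷ ys) x = if does (y ≟ x) then 0 else suc (idxOf ys x)

entryPos : Seg → ℕ
entryPos s = 3 * idxOf (tile s) (v s) + 2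

exitPos : Seg → ℕ
exitPos s = 3 * idxOf (tile s) (u s)

StrictlyBetween : ℕ → ℕ → ℕ → Set
StrictlyBetween a b x = (a < x × x < b) ⊎ (b < x × x < a)

ChordsCross : ℕ → ℕ → ℕ → ℕ → Set
ChordsCross a b c d =
  (a ≢ c × a ≢ d × b ≢ c × b ≢ d) ×
  ((StrictlyBetween a b c × ¬ StrictlyBetween a b d) ⊎
   (¬ StrictlyBetween a b c × StrictlyBetween a b d))

SegCross : Seg → Seg → Set
SegCross s s' = tile s ≡ tile s' ×
  ChordsCross (exitPos s) (entryPos s) (exitPos s') (entryPos s')

Crossing : List Seg → List Seg → Set
Crossing S S' = Σ (Fin (length S) × Fin (length S'))
  (λ ik → SegCross (lookup S (proj₁ ik)) (lookup S' (proj₂ ik)))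

PassesThrough : List Seg → ℕ → ℕ → Set
PassesThrough S a b = Any (λ s → LeavesThrough s a b ⊎ LeavesThrough s b a) S

OnSideA : ℕ → ℕ → List ℕ → Set
OnSideA a b q = All (λ x → a ≤ x × x ≤ b) q

OnSideB : ℕ → ℕ → List ℕ → Set
OnSideB a b q = All (λ x → x ≤ a ⊎ b ≤ x) q

OppositeSides : ℕ → ℕ → List ℕ → List ℕ → Set
OppositeSides a b q q' = (OnSideA a b q × OnSideB a b q') ⊎ (OnSideB a b q × OnSideA a b q')

QuadsBetween : (S : List Seg) → Fin (length S) → Fin (length S) → Set
QuadsBetween S i j = ∀ (m : Fin (length S)) →
  StrictlyBetween (toℕ i) (toℕ j) (toℕ m) → length (tile (lookup S m)) ≡ 4

-- The segment
-- sin = (w , x) enters t through [x , y] (near x); the segment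
-- sout = (y , z) leaves t through [x , y] (near y).  S contains sin at
-- position i (followed forwards from i), S' contains sout at position k
-- (followed backwards from k).
PartI : ∀ {n} → Tiling n → Set
PartI T =
  ∀ (t : List ℕ) → IsTile T t →
  ∀ (x y w z : ℕ) → CycSucc t x y → CycSucc t w x → CycSucc t y z →
  ∀ (S S' : List Seg) → IsStrand T S → IsStrand T S' →
  ∀ (i : Fin (length S)) (k : Fin (length S')) →
  lookup S i ≡ seg t w x → lookup S' k ≡ seg t y z →
  (length t ≡ 3 →
     SegCross (seg t w x) (seg t y z) ×
     (∀ (i' : Fin (length S)) (k' : Fin (length S')) →
        toℕ i ≤ toℕ i' → toℕ k' ≤ toℕ k →
        SegCross (lookup S i') (lookup S' k') → toℕ i' ≡ toℕ i × toℕ k' ≡ toℕ k))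
  ×
  (length t ≡ 4 →
     ∃₂ λ c d → CycSucc t y c × CycSucc t c d × CycSucc t d x ×
       LeavesThrough (seg t w x) c d × EntersThrough (seg t y z) c d)
  ×
  (4 < length t →
     (∀ a b c d → LeavesThrough (seg t w x) a b → EntersThrough (seg t y z) c d →
        ¬ (a ≡ c × b ≡ d)) ×
     (∀ (i' : Fin (length S)) (k' : Fin (length S')) →
        toℕ i ≤ toℕ i' → toℕ k' ≤ toℕ k →
        ¬ SegCross (lookup S i') (lookup S' k')))

PartII : ∀ {n} → Tiling n → Set
PartII T =
  ∀ (S S' : List Seg) → IsStrand T S → IsStrand T S' → S ≢ S' →
  -- at most two crossings
  (∀ (c₁ c₂ c₃ : Crossing S S') →
     proj₁ c₁ ≡ proj₁ c₂ ⊎ proj₁ c₁ ≡ proj₁ c₃ ⊎ proj₁ c₂ ≡ proj₁ c₃)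
  ×
  (∀ (c₁ c₂ : Crossing S S') → proj₁ c₁ ≢ proj₁ c₂ →
     let i₁ = proj₁ (proj₁ c₁) ; k₁ = proj₂ (proj₁ c₁)
         i₂ = proj₁ (proj₁ c₂) ; k₂ = proj₂ (proj₁ c₂)
     in ∃₂ λ a b → (a , b) ∈ diags T ×
          PassesThrough S a b × PassesThrough S' a b ×
          length (tile (lookup S i₁)) ≡ 3 × length (tile (lookup S i₂)) ≡ 3 ×
          OppositeSides a b (tile (lookup S i₁)) (tile (lookup S i₂)) ×
          QuadsBetween S i₁ i₂ × QuadsBetween S' k₁ k₂)

-- Two segments of a tile cross only when they are parallel to adjacent sides: only then do their
-- endpoints interleave on the boundary of the tile. A strand that leaves a tile through a side never
-- returns: every later tile lies in the region cut off by that side, and symmetrically every earlier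
-- tile lies beyond the side it entered through. So two strands meeting in a tile and leaving it through
-- different sides never meet again (Part I); they can only stay together through quadrilaterals, whose
-- opposite side both of them cross. A second crossing therefore forces the first tile to be a triangle
-- whose far side both strands cross, followed by a corridor of quadrilaterals ending in a triangle on
-- the other side, and a third crossing would have to lie in that same corridor, where the crossing is
-- unique (Part II).

module Submission where

open import Defs
open import Data.Nat using (ℕ; zero; suc; _+_; _*_; _∸_; _≤_; _<_; z≤n; s≤s; _≤?_; _<?_; _≡ᵇ_)
open import Data.Nat.Properties
open import Data.Bool using (true; false)
open import Data.Unit using (tt)
open import Data.List using (List; []; _∷_; _++_; length; lookup)
open import Data.List.Properties using (length-++)
open import Data.List.Membership.Propositional using (_∈_; _∉_; lose)
open import Data.List.Membership.Propositional.Properties using (∈-lookup)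
open import Data.List.Membership.DecPropositional _≟_ using (_∈?_)
open import Data.List.Relation.Unary.Any using (Any; here; there)
open import Data.List.Relation.Unary.All as All using (All; []; _∷_)
open import Data.List.Relation.Unary.AllPairs using (AllPairs; []; _∷_)
open import Data.List.Relation.Unary.Linked as Linked using (Linked; []; [-]; _∷_)
open import Data.Fin using (Fin; toℕ; fromℕ<)
open import Data.Fin.Properties using (toℕ-injective; toℕ<n; toℕ-fromℕ<)
open import Data.Product using (Σ; ∃₂; _×_; _,_; proj₁; proj₂; swap)
open import Data.Sum using (_⊎_; inj₁; inj₂; [_,_]′)
open import Data.Empty using (⊥; ⊥-elim)
open import Function using (_∘_)
open import Relation.Nullary using (¬_; Dec; yes; no; ¬?)
open import Relation.Nullary.Decidable using (toWitness; _×-dec_; _⊎-dec_)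
open import Relation.Binary.PropositionalEquality
open import Relation.Binary.Definitions using (tri<; tri≈; tri>)

Cyclic : ℕ → ℕ → ℕ → Set
Cyclic a b c = (a < b × b < c) ⊎ (b < c × c < a) ⊎ (c < a × a < b)

Cyclic-rotate : ∀ {a b c} → Cyclic a b c → Cyclic b c a
Cyclic-rotate (inj₁ p)        = inj₂ (inj₂ p)
Cyclic-rotate (inj₂ (inj₁ p)) = inj₁ p
Cyclic-rotate (inj₂ (inj₂ p)) = inj₂ (inj₁ p)

Cyclic-asym : ∀ {a b c} → Cyclic a b c → ¬ Cyclic a c b
Cyclic-asym (inj₁ (p , q))        (inj₁ (r , s))        = <-asym q s
Cyclic-asym (inj₁ (p , q))        (inj₂ (inj₁ (r , s))) = <-asym p s
Cyclic-asym (inj₁ (p , q))        (inj₂ (inj₂ (r , s))) = <-asym p r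
Cyclic-asym (inj₂ (inj₁ (p , q))) (inj₁ (r , s))        = <-asym p s
Cyclic-asym (inj₂ (inj₁ (p , q))) (inj₂ (inj₁ (r , s))) = <-asym p r
Cyclic-asym (inj₂ (inj₁ (p , q))) (inj₂ (inj₂ (r , s))) = <-asym q s
Cyclic-asym (inj₂ (inj₂ (p , q))) (inj₁ (r , s))        = <-asym p r
Cyclic-asym (inj₂ (inj₂ (p , q))) (inj₂ (inj₁ (r , s))) = <-asym q s
Cyclic-asym (inj₂ (inj₂ (p , q))) (inj₂ (inj₂ (r , s))) = <-asym q r

Cyclic-irrefl : ∀ {a c} → ¬ Cyclic a a c
Cyclic-irrefl (inj₁ (p , q))        = <-irrefl refl p
Cyclic-irrefl (inj₂ (inj₁ (p , q))) = <-asym p q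
Cyclic-irrefl (inj₂ (inj₂ (p , q))) = <-irrefl refl q

Cyclic⇒≢₁₂ : ∀ {a b c} → Cyclic a b c → a ≢ b
Cyclic⇒≢₁₂ h refl = Cyclic-irrefl h

Cyclic⇒≢₂₃ : ∀ {a b c} → Cyclic a b c → b ≢ c
Cyclic⇒≢₂₃ h refl = Cyclic-irrefl (Cyclic-rotate h)

Cyclic⇒≢₁₃ : ∀ {a b c} → Cyclic a b c → a ≢ c
Cyclic⇒≢₁₃ h refl = Cyclic-irrefl (Cyclic-rotate (Cyclic-rotate h))

Cyclic-total : ∀ {a b c} → a ≢ b → b ≢ c → a ≢ c → Cyclic a b c ⊎ Cyclic a c b
Cyclic-total {a} {b} {c} a≢b b≢c a≢c with <-cmp a b | <-cmp b c | <-cmp a c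
... | tri≈ _ e _ | _ | _ = ⊥-elim (a≢b e)
... | _ | tri≈ _ e _ | _ = ⊥-elim (b≢c e)
... | _ | _ | tri≈ _ e _ = ⊥-elim (a≢c e)
... | tri< ab _ _ | tri< bc _ _ | tri< ac _ _ = inj₁ (inj₁ (ab , bc))
... | tri< ab _ _ | tri< bc _ _ | tri> _ _ ca = ⊥-elim (<-asym (<-trans ab bc) ca)
... | tri< ab _ _ | tri> _ _ cb | tri< ac _ _ = inj₂ (inj₁ (ac , cb))
... | tri< ab _ _ | tri> _ _ cb | tri> _ _ ca = inj₁ (inj₂ (inj₂ (ca , ab)))
... | tri> _ _ ba | tri< bc _ _ | tri< ac _ _ = inj₂ (inj₂ (inj₂ (ba , ac)))
... | tri> _ _ ba | tri< bc _ _ | tri> _ _ ca = inj₁ (inj₂ (inj₁ (bc , ca)))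
... | tri> _ _ ba | tri> _ _ cb | tri< ac _ _ = ⊥-elim (<-asym (<-trans cb ba) ac)
... | tri> _ _ ba | tri> _ _ cb | tri> _ _ ca = inj₂ (inj₂ (inj₁ (cb , ba)))

Cyclic-trans : ∀ {a b c d} → Cyclic a b c → Cyclic a c d → Cyclic b c d
Cyclic-trans (inj₁ (ab , bc))        (inj₁ (ac , cd))        = inj₁ (bc , cd)
Cyclic-trans (inj₁ (ab , bc))        (inj₂ (inj₁ (cd , da))) = ⊥-elim (<-asym (<-trans ab bc) (<-trans cd da))
Cyclic-trans (inj₁ (ab , bc))        (inj₂ (inj₂ (da , ac))) = inj₂ (inj₂ (<-trans da ab , bc))
Cyclic-trans (inj₂ (inj₁ (bc , ca))) (inj₁ (ac , cd))        = ⊥-elim (<-asym ac ca)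
Cyclic-trans (inj₂ (inj₁ (bc , ca))) (inj₂ (inj₁ (cd , da))) = inj₁ (bc , cd)
Cyclic-trans (inj₂ (inj₁ (bc , ca))) (inj₂ (inj₂ (da , ac))) = ⊥-elim (<-asym ac ca)
Cyclic-trans (inj₂ (inj₂ (ca , ab))) (inj₁ (ac , cd))        = ⊥-elim (<-asym ac ca)
Cyclic-trans (inj₂ (inj₂ (ca , ab))) (inj₂ (inj₁ (cd , da))) = inj₂ (inj₁ (cd , <-trans da ab))
Cyclic-trans (inj₂ (inj₂ (ca , ab))) (inj₂ (inj₂ (da , ac))) = ⊥-elim (<-asym ac ca)

Arc : ℕ → ℕ → ℕ → Set
Arc a b z = z ≡ a ⊎ z ≡ b ⊎ Cyclic a z b

Arc-complement : ∀ {a b z} → a ≢ b → ¬ Cyclic b z a → Arc a b z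
Arc-complement {a} {b} {z} a≢b ¬bza with z ≟ a | z ≟ b
... | yes e | _ = inj₁ e
... | no _ | yes e = inj₂ (inj₁ e)
... | no z≢a | no z≢b with Cyclic-total {a} {z} {b} (z≢a ∘ sym) z≢b a≢b
...   | inj₁ h = inj₂ (inj₂ h)
...   | inj₂ h = ⊥-elim (¬bza (Cyclic-rotate h))

open-arcs-coincide : ∀ {a b c d z} → Cyclic a z b → Cyclic c z d →
  ¬ Cyclic a c b → ¬ Cyclic a d b → ¬ Cyclic c a d → ¬ Cyclic c b d → a ≡ c × b ≡ d
open-arcs-coincide {a} {b} {c} {d} {z} azb czd ¬acb ¬adb ¬cad ¬cbd = a≡c , b≡d
  where
  zba : Cyclic z b a
  zba = Cyclic-rotate azb
  zdc : Cyclic z d c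
  zdc = Cyclic-rotate czd
  b≡d : b ≡ d
  b≡d with b ≟ d
  ... | yes e = e
  ... | no b≢d with Cyclic-total {z} {b} {d} (Cyclic⇒≢₁₂ zba) b≢d (Cyclic⇒≢₁₂ zdc)
  ...   | inj₁ zbd = ⊥-elim (¬cbd (Cyclic-rotate (Cyclic-rotate (Cyclic-trans zbd zdc))))
  ...   | inj₂ zdb = ⊥-elim (¬adb (Cyclic-rotate (Cyclic-rotate (Cyclic-trans zdb zba))))
  a≡c : a ≡ c
  a≡c with a ≟ c
  ... | yes e = e
  ... | no a≢c with Cyclic-total {b} {a} {c} (Cyclic⇒≢₁₃ azb ∘ sym) a≢c
                      (λ e → Cyclic⇒≢₁₃ czd (trans (sym e) b≡d))
  ...   | inj₁ bac = ⊥-elim (¬acb (Cyclic-rotate bac))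
  ...   | inj₂ bca = ⊥-elim (¬cad (subst (Cyclic c a) b≡d (Cyclic-rotate bca)))

Sorted : List ℕ → Set
Sorted = Linked _<_

-- Positions out of range give the junk value 0; every use below carries a range proof.
nth : List ℕ → ℕ → ℕ
nth []       _       = 0
nth (x ∷ xs) zero    = x
nth (x ∷ xs) (suc p) = nth xs p

idxOf-head : ∀ {y x ys} → y ≡ x → idxOf (y ∷ ys) x ≡ 0
idxOf-head {y} {x} y≡x with y ≡ᵇ x | ≡⇒≡ᵇ y x y≡x
... | true | _ = refl

idxOf-tail : ∀ {y x ys} → y ≢ x → idxOf (y ∷ ys) x ≡ suc (idxOf ys x)
idxOf-tail {y} {x} y≢x with y ≡ᵇ x | ≡ᵇ⇒≡ y x
... | true  | ≡ᵇ⇒≡ = ⊥-elim (y≢x (≡ᵇ⇒≡ tt))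
... | false | _    = refl

head<nth : ∀ {x xs p} → Sorted (x ∷ xs) → p < length xs → x < nth xs p
head<nth {p = zero}  (x<y ∷ _)  _         = x<y
head<nth {p = suc p} (x<y ∷ xs) (s≤s lt) = <-trans x<y (head<nth xs lt)

head<∈ : ∀ {x xs z} → Sorted (x ∷ xs) → z ∈ xs → x < z
head<∈ (x<y ∷ _)  (here refl) = x<y
head<∈ (x<y ∷ xs) (there z∈)  = <-trans x<y (head<∈ xs z∈)

nth-mono-< : ∀ {xs p q} → Sorted xs → p < q → q < length xs → nth xs p < nth xs q
nth-mono-< {x ∷ xs} {zero}  {suc q} s _        (s≤s lt) = head<nth s lt
nth-mono-< {x ∷ xs} {suc p} {suc q} s (s≤s pq) (s≤s lt) = nth-mono-< (Linked.tail s) pq lt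

nth-mono-≤ : ∀ {xs p q} → Sorted xs → p ≤ q → q < length xs → nth xs p ≤ nth xs q
nth-mono-≤ s p≤q lt with m≤n⇒m<n∨m≡n p≤q
... | inj₁ p<q  = <⇒≤ (nth-mono-< s p<q lt)
... | inj₂ refl = ≤-refl

nth∈ : ∀ {xs p} → p < length xs → nth xs p ∈ xs
nth∈ {x ∷ xs} {zero}  _        = here refl
nth∈ {x ∷ xs} {suc p} (s≤s lt) = there (nth∈ lt)

∈⇒nth : ∀ {xs z} → z ∈ xs → Σ ℕ λ p → p < length xs × nth xs p ≡ z
∈⇒nth (here refl) = 0 , s≤s z≤n , refl
∈⇒nth (there z∈) with ∈⇒nth z∈
... | p , lt , e = suc p , s≤s lt , e

idxOf-nth : ∀ {xs p} → Sorted xs → p < length xs → idxOf xs (nth xs p) ≡ p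
idxOf-nth {x ∷ xs} {zero}  s _        = idxOf-head {x} {x} {xs} refl
idxOf-nth {x ∷ xs} {suc p} s (s≤s lt) =
  trans (idxOf-tail {x} {nth xs p} {xs} (λ e → <-irrefl e (head<nth s lt)))
        (cong suc (idxOf-nth (Linked.tail s) lt))

idxOf-∈ : ∀ {xs z} → Sorted xs → z ∈ xs →
  Σ ℕ λ p → p < length xs × nth xs p ≡ z × idxOf xs z ≡ p
idxOf-∈ s z∈ with ∈⇒nth z∈
... | p , lt , refl = p , lt , refl , idxOf-nth s lt

idxOf<length : ∀ {xs z} → Sorted xs → z ∈ xs → idxOf xs z < length xs
idxOf<length s z∈ with idxOf-∈ s z∈
... | p , lt , _ , e = subst (_< _) (sym e) lt

idxOf-injective : ∀ {xs a b} → Sorted xs → a ∈ xs → b ∈ xs → idxOf xs a ≡ idxOf xs b → a ≡ b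
idxOf-injective {xs} s a∈ b∈ e with idxOf-∈ s a∈ | idxOf-∈ s b∈
... | p , _ , refl , ep | q , _ , refl , eq = cong (nth xs) (trans (sym ep) (trans e eq))

sorted-≡ : ∀ {xs ys} → Sorted xs → Sorted ys →
  (∀ {z} → z ∈ xs → z ∈ ys) → (∀ {z} → z ∈ ys → z ∈ xs) → xs ≡ ys
sorted-≡ {[]}     {[]}     _  _  _ _ = refl
sorted-≡ {[]}     {y ∷ ys} _  _  _ g with g (here refl)
... | ()
sorted-≡ {x ∷ xs} {[]}     _  _  f _ with f (here refl)
... | ()
sorted-≡ {x ∷ xs} {y ∷ ys} sx sy f g with f (here refl) | g (here refl)
... | here refl | _ = cong (x ∷_) (sorted-≡ (Linked.tail sx) (Linked.tail sy) (drop sx sy f) (drop sy sx g))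
  where
  drop : ∀ {x xs ys} → Sorted (x ∷ xs) → Sorted (x ∷ ys) →
    (∀ {z} → z ∈ x ∷ xs → z ∈ x ∷ ys) → ∀ {z} → z ∈ xs → z ∈ ys
  drop sx sy f z∈ with f (there z∈)
  ... | here refl = ⊥-elim (<-irrefl refl (head<∈ sx z∈))
  ... | there z∈′ = z∈′
... | there x∈ | here refl = ⊥-elim (<-irrefl refl (head<∈ sy x∈))
... | there x∈ | there y∈ = ⊥-elim (<-asym (head<∈ sy x∈) (head<∈ sx y∈))

CycStep : ℕ → ℕ → ℕ → Set
CycStep r i j = j ≡ suc i ⊎ (suc i ≡ r × j ≡ 0)

CycStep-pred-unique : ∀ {r i i′ j} → CycStep r i j → CycStep r i′ j → i ≡ i′
CycStep-pred-unique (inj₁ refl)          (inj₁ refl)        = refl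
CycStep-pred-unique (inj₁ refl)          (inj₂ (_ , ()))
CycStep-pred-unique (inj₂ (_ , refl))    (inj₁ ())
CycStep-pred-unique (inj₂ (refl , refl)) (inj₂ (e , refl)) = sym (suc-injective e)

CycStep-succ-unique : ∀ {r i j j′} → j < r → j′ < r → CycStep r i j → CycStep r i j′ → j ≡ j′
CycStep-succ-unique _ _ (inj₁ refl)          (inj₁ refl)          = refl
CycStep-succ-unique l _ (inj₁ refl)          (inj₂ (refl , refl)) = ⊥-elim (<-irrefl refl l)
CycStep-succ-unique _ l (inj₂ (refl , refl)) (inj₁ refl)          = ⊥-elim (<-irrefl refl l)
CycStep-succ-unique _ _ (inj₂ (_ , refl))    (inj₂ (_ , refl))    = refl

CycStep-no-2-cycle : ∀ {r i j} → 3 ≤ r → CycStep r i j → ¬ CycStep r j i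
CycStep-no-2-cycle _                (inj₁ refl)          (inj₁ ())
CycStep-no-2-cycle (s≤s (s≤s ())) (inj₁ refl)          (inj₂ (refl , refl))
CycStep-no-2-cycle (s≤s (s≤s ())) (inj₂ (refl , refl)) (inj₁ refl)

CycStep-3-cycle : ∀ {r i j k} → 3 ≤ r → CycStep r i j → CycStep r j k → CycStep r k i → r ≡ 3
CycStep-3-cycle _       (inj₁ refl)          (inj₁ refl)          (inj₁ ())
CycStep-3-cycle _       (inj₁ refl)          (inj₁ refl)          (inj₂ (refl , refl)) = refl
CycStep-3-cycle _       (inj₁ refl)          (inj₂ (refl , refl)) (inj₁ refl)          = refl
CycStep-3-cycle _       (inj₁ refl)          (inj₂ (refl , refl)) (inj₂ (() , refl))
CycStep-3-cycle _       (inj₂ (refl , refl)) (inj₁ refl)          (inj₁ refl)          = refl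
CycStep-3-cycle _       (inj₂ (refl , refl)) (inj₁ refl)          (inj₂ (() , refl))
CycStep-3-cycle (s≤s ()) (inj₂ (refl , refl)) (inj₂ (refl , refl)) _

CycStep-4-cycle : ∀ {r i j k l} → 3 ≤ r →
  CycStep r i j → CycStep r j k → CycStep r k l → CycStep r l i → r ≡ 4
CycStep-4-cycle _ (inj₁ refl) (inj₁ refl) (inj₁ refl) (inj₁ ())
CycStep-4-cycle _ (inj₁ refl) (inj₁ refl) (inj₁ refl) (inj₂ (refl , refl)) = refl
CycStep-4-cycle _ (inj₁ refl) (inj₁ refl) (inj₂ (refl , refl)) (inj₁ refl) = refl
CycStep-4-cycle _ (inj₁ refl) (inj₁ refl) (inj₂ (refl , refl)) (inj₂ (() , refl))
CycStep-4-cycle _ (inj₁ refl) (inj₂ (refl , refl)) (inj₁ refl) (inj₁ refl) = refl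
CycStep-4-cycle (s≤s (s≤s ())) (inj₁ refl) (inj₂ (refl , refl)) (inj₁ refl) (inj₂ (refl , refl))
CycStep-4-cycle _ (inj₁ refl) (inj₂ (refl , refl)) (inj₂ (() , refl)) _
CycStep-4-cycle _ (inj₂ (refl , refl)) (inj₁ refl) (inj₁ refl) (inj₁ refl) = refl
CycStep-4-cycle _ (inj₂ (refl , refl)) (inj₁ refl) (inj₁ refl) (inj₂ (() , refl))
CycStep-4-cycle (s≤s (s≤s ())) (inj₂ (refl , refl)) (inj₁ refl) (inj₂ (refl , refl)) _
CycStep-4-cycle (s≤s ()) (inj₂ (refl , refl)) (inj₂ (refl , refl)) _ _

next : ℕ → ℕ → ℕ
next r i with suc i ≟ r
... | yes _ = 0
... | no _  = suc i

CycStep⇒next : ∀ {r i j} → j < r → CycStep r i j → j ≡ next r i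
CycStep⇒next {r} {i} j<r (inj₁ refl) with suc i ≟ r
... | yes refl = ⊥-elim (<-irrefl refl j<r)
... | no _     = refl
CycStep⇒next {r} {i} j<r (inj₂ (refl , refl)) with suc i ≟ suc i
... | yes _ = refl
... | no ne = ⊥-elim (ne refl)

next³ : ∀ i → i < 3 → next 3 (next 3 (next 3 i)) ≡ i
next³ 0 _ = refl
next³ 1 _ = refl
next³ 2 _ = refl
next³ (suc (suc (suc i))) (s≤s (s≤s (s≤s ())))

next⁴ : ∀ i → i < 4 → next 4 (next 4 (next 4 (next 4 i))) ≡ i
next⁴ 0 _ = refl
next⁴ 1 _ = refl
next⁴ 2 _ = refl
next⁴ 3 _ = refl
next⁴ (suc (suc (suc (suc i)))) (s≤s (s≤s (s≤s (s≤s ()))))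

Consec⇒nth : ∀ {ys a b} → Consec ys a b →
  Σ ℕ λ p → suc p < length ys × nth ys p ≡ a × nth ys (suc p) ≡ b
Consec⇒nth {x ∷ y ∷ ys} (inj₁ (refl , refl)) = 0 , s≤s (s≤s z≤n) , refl , refl
Consec⇒nth {x ∷ y ∷ ys} (inj₂ c) with Consec⇒nth {y ∷ ys} c
... | p , lt , e₁ , e₂ = suc p , s≤s lt , e₁ , e₂

nth⇒Consec : ∀ {ys p} → suc p < length ys → Consec ys (nth ys p) (nth ys (suc p))
nth⇒Consec {x ∷ []}     {_}     (s≤s ())
nth⇒Consec {x ∷ y ∷ ys} {zero}  _        = inj₁ (refl , refl)
nth⇒Consec {x ∷ y ∷ ys} {suc p} (s≤s lt) = inj₂ (nth⇒Consec {y ∷ ys} {p} lt)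

nth-++ˡ : ∀ {xs ys p} → p < length xs → nth (xs ++ ys) p ≡ nth xs p
nth-++ˡ {x ∷ xs} {ys} {zero}  _        = refl
nth-++ˡ {x ∷ xs} {ys} {suc p} (s≤s lt) = nth-++ˡ {xs} {ys} lt

nth-++-last : ∀ {xs h} → nth (xs ++ h ∷ []) (length xs) ≡ h
nth-++-last {[]}     = refl
nth-++-last {x ∷ xs} = nth-++-last {xs}

length-∷ʳ : ∀ (xs : List ℕ) h → length (xs ++ h ∷ []) ≡ suc (length xs)
length-∷ʳ xs h = trans (length-++ xs) (+-comm (length xs) 1)

CycSucc⇒nth : ∀ {t a b} → CycSucc t a b →
  Σ ℕ λ p → p < length t × nth t p ≡ a ×
    ((suc p < length t × nth t (suc p) ≡ b) ⊎ (suc p ≡ length t × nth t 0 ≡ b))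
CycSucc⇒nth {h ∷ t} c with Consec⇒nth {(h ∷ t) ++ h ∷ []} c
... | p , lt , e₁ , e₂ with subst (suc p <_) (length-∷ʳ (h ∷ t) h) lt
... | s≤s p≤ with m≤n⇒m<n∨m≡n p≤
... | inj₁ sp< = p , <⇒≤ sp< ,
        trans (sym (nth-++ˡ {h ∷ t} {h ∷ []} (<⇒≤ sp<))) e₁ ,
        inj₁ (sp< , trans (sym (nth-++ˡ {h ∷ t} {h ∷ []} sp<)) e₂)
... | inj₂ refl = p , ≤-refl ,
        trans (sym (nth-++ˡ {h ∷ t} {h ∷ []} ≤-refl)) e₁ ,
        inj₂ (refl , trans (sym (nth-++-last {h ∷ t} {h})) e₂)

nth⇒CycSucc : ∀ {t p} → suc p < length t → CycSucc t (nth t p) (nth t (suc p))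
nth⇒CycSucc {h ∷ t} {p} lt =
  subst₂ (Consec ((h ∷ t) ++ h ∷ [])) (nth-++ˡ {h ∷ t} {h ∷ []} (<⇒≤ lt)) (nth-++ˡ {h ∷ t} {h ∷ []} lt)
    (nth⇒Consec {(h ∷ t) ++ h ∷ []} {p}
      (subst (suc p <_) (sym (length-∷ʳ (h ∷ t) h)) (<-trans lt (n<1+n _))))

nth⇒CycSucc-wrap : ∀ {t p} → suc p ≡ length t → CycSucc t (nth t p) (nth t 0)
nth⇒CycSucc-wrap {h ∷ t} {p} e =
  subst₂ (Consec ((h ∷ t) ++ h ∷ [])) (nth-++ˡ {h ∷ t} {h ∷ []} (subst (p <_) e ≤-refl))
    (trans (cong (nth ((h ∷ t) ++ h ∷ [])) e) (nth-++-last {h ∷ t} {h}))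
    (nth⇒Consec {(h ∷ t) ++ h ∷ []} {p}
      (subst (suc p <_) (sym (length-∷ʳ (h ∷ t) h)) (subst (_< suc (length (h ∷ t))) (sym e) ≤-refl)))

CycSucc⇒CycStep : ∀ {t a b} → Sorted t → CycSucc t a b → CycStep (length t) (idxOf t a) (idxOf t b)
CycSucc⇒CycStep {t} {a} {b} s c with CycSucc⇒nth {t} {a} {b} c
... | p , lt , refl , inj₁ (lt′ , refl) = inj₁ (trans (idxOf-nth s lt′) (cong suc (sym (idxOf-nth s lt))))
... | p , lt , refl , inj₂ (e , refl)   =
  inj₂ (trans (cong suc (idxOf-nth s lt)) e , idxOf-nth s (≤-trans (s≤s z≤n) lt))

CycSucc⇒∈ : ∀ {t a b} → CycSucc t a b → a ∈ t × b ∈ t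
CycSucc⇒∈ {t} {a} {b} c with CycSucc⇒nth {t} {a} {b} c
... | p , lt , refl , inj₁ (lt′ , refl) = nth∈ lt , nth∈ lt′
... | p , lt , refl , inj₂ (e , refl)   = nth∈ lt , nth∈ (≤-trans (s≤s z≤n) lt)

CycSucc-gap : ∀ {t a b z} → Sorted t → CycSucc t a b → z ∈ t → ¬ Cyclic a z b
CycSucc-gap {t} {a} {b} s c z∈ with CycSucc⇒nth {t} {a} {b} c | ∈⇒nth z∈
... | p , lt , refl , inj₁ (lt′ , refl) | q , q< , refl = inner
  where
  inner : ¬ Cyclic (nth t p) (nth t q) (nth t (suc p))
  inner (inj₁ (az , zb)) with <-cmp p q
  ... | tri< p<q _ _ = <-irrefl refl (<-≤-trans zb (nth-mono-≤ s p<q q<))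
  ... | tri≈ _ refl _ = <-irrefl refl az
  ... | tri> _ _ q<p = <-irrefl refl (<-≤-trans az (nth-mono-≤ s (<⇒≤ q<p) lt))
  inner (inj₂ (inj₁ (_ , ba))) = <-asym (nth-mono-< s (n<1+n p) lt′) ba
  inner (inj₂ (inj₂ (ba , _))) = <-asym (nth-mono-< s (n<1+n p) lt′) ba
... | p , lt , refl , inj₂ (e , refl) | q , q< , refl = wrap
  where
  z≤a : nth t q ≤ nth t p
  z≤a = nth-mono-≤ s (≤-pred (subst (q <_) (sym e) q<)) lt
  b≤z : nth t 0 ≤ nth t q
  b≤z = nth-mono-≤ s z≤n q<
  wrap : ¬ Cyclic (nth t p) (nth t q) (nth t 0)
  wrap (inj₁ (az , _))        = <-irrefl refl (<-≤-trans az z≤a)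
  wrap (inj₂ (inj₁ (zb , _))) = <-irrefl refl (<-≤-trans zb b≤z)
  wrap (inj₂ (inj₂ (_ , az))) = <-irrefl refl (<-≤-trans az z≤a)

CycSucc-succ : ∀ {t z} → z ∈ t → Σ ℕ λ b → CycSucc t z b
CycSucc-succ {t} z∈ with ∈⇒nth z∈
... | p , lt , refl with m≤n⇒m<n∨m≡n lt
...   | inj₁ l = nth t (suc p) , nth⇒CycSucc {t} {p} l
...   | inj₂ e = nth t 0 , nth⇒CycSucc-wrap {t} {p} e

CycSucc-pred : ∀ {t z} → z ∈ t → Σ ℕ λ a → CycSucc t a z
CycSucc-pred {t@(_ ∷ _)} z∈ with ∈⇒nth z∈
... | zero  , _  , refl = nth t (length t ∸ 1) , nth⇒CycSucc-wrap {t} {length t ∸ 1} refl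
... | suc p , lt , refl = nth t p , nth⇒CycSucc {t} {p} lt

gap-between : ∀ {xs z} → Sorted xs → nth xs 0 < z → Any (z <_) xs → z ∉ xs →
  Σ ℕ λ p → suc p < length xs × nth xs p < z × z < nth xs (suc p)
gap-between {x ∷ []}     s x<z (here z<x) _ = ⊥-elim (<-asym x<z z<x)
gap-between {x ∷ y ∷ ys} {z} s x<z above z∉ with <-cmp z y
... | tri< z<y _ _ = 0 , s≤s (s≤s z≤n) , x<z , z<y
... | tri≈ _ refl _ = ⊥-elim (z∉ (there (here refl)))
... | tri> _ _ y<z with above
...   | here z<x = ⊥-elim (<-asym x<z z<x)
...   | there above′ with gap-between {y ∷ ys} (Linked.tail s) y<z above′ (z∉ ∘ there)
...     | p , lt , l , r = suc p , s≤s lt , l , r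

∉⇒inside-side : ∀ {t z} → Sorted t → 2 ≤ length t → z ∉ t →
  Σ ℕ λ a → Σ ℕ λ b → CycSucc t a b × Cyclic a z b
∉⇒inside-side {_ ∷ []} _ (s≤s ()) _
∉⇒inside-side {t@(_ ∷ _ ∷ _)} {z} s _ z∉ with <-cmp z (nth t 0) | <-cmp z (nth t (length t ∸ 1))
... | tri≈ _ refl _ | _ = ⊥-elim (z∉ (here refl))
... | _ | tri≈ _ refl _ = ⊥-elim (z∉ (nth∈ {t} {length t ∸ 1} ≤-refl))
... | tri< z<f _ _ | _ = last , first , wrap , inj₂ (inj₁ (z<f , first<last))
  where
  last = nth t (length t ∸ 1)
  first = nth t 0
  wrap = nth⇒CycSucc-wrap {t} {length t ∸ 1} refl
  first<last : first < last
  first<last = nth-mono-< s (s≤s z≤n) ≤-refl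
... | tri> _ _ f<z | tri> _ _ l<z = last , first , wrap , inj₂ (inj₂ (first<last , l<z))
  where
  last = nth t (length t ∸ 1)
  first = nth t 0
  wrap = nth⇒CycSucc-wrap {t} {length t ∸ 1} refl
  first<last : first < last
  first<last = nth-mono-< s (s≤s z≤n) ≤-refl
... | tri> _ _ f<z | tri< z<l _ _ with gap-between s f<z (lose (nth∈ {t} {length t ∸ 1} ≤-refl) z<l) z∉
...   | p , lt , l , r = nth t p , nth t (suc p) , nth⇒CycSucc {t} {p} lt , inj₁ (l , r)

module _ {t : List ℕ} (srt : Sorted t) where

  private
    idx< : ∀ {a b} → CycSucc t a b → idxOf t a < length t × idxOf t b < length t
    idx< c = idxOf<length srt (proj₁ (CycSucc⇒∈ c)) , idxOf<length srt (proj₂ (CycSucc⇒∈ c))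

  succ-unique : ∀ {a b b′} → CycSucc t a b → CycSucc t a b′ → b ≡ b′
  succ-unique c c′ = idxOf-injective srt (proj₂ (CycSucc⇒∈ c)) (proj₂ (CycSucc⇒∈ c′))
    (CycStep-succ-unique (proj₂ (idx< c)) (proj₂ (idx< c′)) (CycSucc⇒CycStep srt c) (CycSucc⇒CycStep srt c′))

  pred-unique : ∀ {a a′ b} → CycSucc t a b → CycSucc t a′ b → a ≡ a′
  pred-unique c c′ = idxOf-injective srt (proj₁ (CycSucc⇒∈ c)) (proj₁ (CycSucc⇒∈ c′))
    (CycStep-pred-unique (CycSucc⇒CycStep srt c) (CycSucc⇒CycStep srt c′))

  CycSucc⇒≢ : ∀ {a b} → 2 ≤ length t → CycSucc t a b → a ≢ b
  CycSucc⇒≢ r≥2 c refl with CycSucc⇒CycStep srt c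
  ... | inj₁ e        = 1+n≢n (sym e)
  ... | inj₂ (e , e′) = <-irrefl (trans (cong suc (sym e′)) e) r≥2

  no-2-cycle : ∀ {a b} → 3 ≤ length t → CycSucc t a b → ¬ CycSucc t b a
  no-2-cycle r≥3 c c′ = CycStep-no-2-cycle r≥3 (CycSucc⇒CycStep srt c) (CycSucc⇒CycStep srt c′)

  3-cycle⇒triangle : ∀ {a b c} → 3 ≤ length t →
    CycSucc t a b → CycSucc t b c → CycSucc t c a → length t ≡ 3
  3-cycle⇒triangle r≥3 x y z =
    CycStep-3-cycle r≥3 (CycSucc⇒CycStep srt x) (CycSucc⇒CycStep srt y) (CycSucc⇒CycStep srt z)

  4-cycle⇒quadrilateral : ∀ {a b c d} → 3 ≤ length t →
    CycSucc t a b → CycSucc t b c → CycSucc t c d → CycSucc t d a → length t ≡ 4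
  4-cycle⇒quadrilateral r≥3 x y z w = CycStep-4-cycle r≥3
    (CycSucc⇒CycStep srt x) (CycSucc⇒CycStep srt y) (CycSucc⇒CycStep srt z) (CycSucc⇒CycStep srt w)

  private
    idx-next : ∀ {a b} → CycSucc t a b → idxOf t b ≡ next (length t) (idxOf t a)
    idx-next c = CycStep⇒next (proj₂ (idx< c)) (CycSucc⇒CycStep srt c)

  triangle-closes : ∀ {a b c d} → length t ≡ 3 →
    CycSucc t a b → CycSucc t b c → CycSucc t c d → d ≡ a
  triangle-closes {a} {b} {c} {d} e x y z =
    idxOf-injective srt (proj₂ (CycSucc⇒∈ z)) (proj₁ (CycSucc⇒∈ x)) idx≡
    where
    open ≡-Reasoning
    r = length t
    idx≡ : idxOf t d ≡ idxOf t a
    idx≡ = begin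
      idxOf t d                              ≡⟨ idx-next z ⟩
      next r (idxOf t c)                     ≡⟨ cong (next r) (trans (idx-next y) (cong (next r) (idx-next x))) ⟩
      next r (next r (next r (idxOf t a)))   ≡⟨ cong (λ m → next m (next m (next m (idxOf t a)))) e ⟩
      next 3 (next 3 (next 3 (idxOf t a)))   ≡⟨ next³ (idxOf t a) (subst (idxOf t a <_) e (proj₁ (idx< x))) ⟩
      idxOf t a                              ∎

  quadrilateral-closes : ∀ {a b c d f} → length t ≡ 4 →
    CycSucc t a b → CycSucc t b c → CycSucc t c d → CycSucc t d f → f ≡ a
  quadrilateral-closes {a} {b} {c} {d} {f} e x y z w =
    idxOf-injective srt (proj₂ (CycSucc⇒∈ w)) (proj₁ (CycSucc⇒∈ x)) idx≡
    where
    open ≡-Reasoning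
    r = length t
    idx≡ : idxOf t f ≡ idxOf t a
    idx≡ = begin
      idxOf t f                                       ≡⟨ idx-next w ⟩
      next r (idxOf t d)                              ≡⟨ cong (next r) (trans (idx-next z)
                                                           (cong (next r) (trans (idx-next y) (cong (next r) (idx-next x))))) ⟩
      next r (next r (next r (next r (idxOf t a))))   ≡⟨ cong (λ m → next m (next m (next m (next m (idxOf t a))))) e ⟩
      next 4 (next 4 (next 4 (next 4 (idxOf t a))))   ≡⟨ next⁴ (idxOf t a) (subst (idxOf t a <_) e (proj₁ (idx< x))) ⟩
      idxOf t a                                       ∎

  tile⊆Arc : ∀ {x y z} → 2 ≤ length t → CycSucc t y x → z ∈ t → Arc x y z
  tile⊆Arc r≥2 c z∈ = Arc-complement (CycSucc⇒≢ r≥2 c ∘ sym) (CycSucc-gap srt c z∈)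

  side-Arc∩tile : ∀ {p q z} → CycSucc t p q → z ∈ t → Arc p q z → z ≡ p ⊎ z ≡ q
  side-Arc∩tile c z∈ (inj₁ e)         = inj₁ e
  side-Arc∩tile c z∈ (inj₂ (inj₁ e))  = inj₂ e
  side-Arc∩tile c z∈ (inj₂ (inj₂ cz)) = ⊥-elim (CycSucc-gap srt c z∈ cz)

  tile⊈side-Arc : ∀ {p q} → 3 ≤ length t → CycSucc t p q → ¬ (∀ {z} → z ∈ t → Arc p q z)
  tile⊈side-Arc {p} {q} r≥3 c inArc =
    no-3-in-pair (nth-mono-< srt 0<1 1<r) (nth-mono-< srt 1<2 r≥3) (on 0<r) (on 1<r) (on r≥3)
    where
    0<1 : 0 < 1
    0<1 = s≤s z≤n
    1<2 : 1 < 2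
    1<2 = s≤s 0<1
    0<r = ≤-trans (s≤s z≤n) r≥3
    1<r = ≤-trans (s≤s (s≤s z≤n)) r≥3
    on : ∀ {i} → i < length t → nth t i ≡ p ⊎ nth t i ≡ q
    on i<r = side-Arc∩tile c (nth∈ i<r) (inArc (nth∈ i<r))
    no-3-in-pair : ∀ {x y z} → x < y → y < z →
      x ≡ p ⊎ x ≡ q → y ≡ p ⊎ y ≡ q → z ≡ p ⊎ z ≡ q → ⊥
    no-3-in-pair x<y y<z (inj₁ refl) (inj₁ refl) _ = <-irrefl refl x<y
    no-3-in-pair x<y y<z (inj₂ refl) (inj₂ refl) _ = <-irrefl refl x<y
    no-3-in-pair x<y y<z _ (inj₁ refl) (inj₁ refl) = <-irrefl refl y<z
    no-3-in-pair x<y y<z _ (inj₂ refl) (inj₂ refl) = <-irrefl refl y<z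
    no-3-in-pair x<y y<z (inj₁ refl) (inj₂ refl) (inj₁ refl) = <-asym x<y y<z
    no-3-in-pair x<y y<z (inj₂ refl) (inj₁ refl) (inj₂ refl) = <-asym x<y y<z

  side-Arcs-meet : ∀ {p q p′ q′ z} → CycSucc t p q → CycSucc t p′ q′ → ¬ (p ≡ p′ × q ≡ q′) →
    Arc p q z → Arc p′ q′ z → (z ≡ q × z ≡ p′) ⊎ (z ≡ p × z ≡ q′)
  side-Arcs-meet c c′ ne (inj₁ refl) (inj₁ e) =
    ⊥-elim (ne (e , succ-unique c (subst (λ w → CycSucc t w _) (sym e) c′)))
  side-Arcs-meet c c′ ne (inj₁ refl) (inj₂ (inj₁ e)) = inj₂ (refl , e)
  side-Arcs-meet c c′ ne (inj₁ refl) (inj₂ (inj₂ cz)) = ⊥-elim (CycSucc-gap srt c′ (proj₁ (CycSucc⇒∈ c)) cz)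
  side-Arcs-meet c c′ ne (inj₂ (inj₁ refl)) (inj₁ e) = inj₁ (refl , e)
  side-Arcs-meet c c′ ne (inj₂ (inj₁ refl)) (inj₂ (inj₁ e)) =
    ⊥-elim (ne (pred-unique c (subst (CycSucc t _) (sym e) c′) , e))
  side-Arcs-meet c c′ ne (inj₂ (inj₁ refl)) (inj₂ (inj₂ cz)) = ⊥-elim (CycSucc-gap srt c′ (proj₂ (CycSucc⇒∈ c)) cz)
  side-Arcs-meet c c′ ne (inj₂ (inj₂ cz)) (inj₁ refl) = ⊥-elim (CycSucc-gap srt c (proj₁ (CycSucc⇒∈ c′)) cz)
  side-Arcs-meet c c′ ne (inj₂ (inj₂ cz)) (inj₂ (inj₁ refl)) = ⊥-elim (CycSucc-gap srt c (proj₂ (CycSucc⇒∈ c′)) cz)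
  side-Arcs-meet c c′ ne (inj₂ (inj₂ cz)) (inj₂ (inj₂ cz′)) = ⊥-elim (ne (open-arcs-coincide cz cz′
    (CycSucc-gap srt c (proj₁ (CycSucc⇒∈ c′))) (CycSucc-gap srt c (proj₂ (CycSucc⇒∈ c′)))
    (CycSucc-gap srt c′ (proj₁ (CycSucc⇒∈ c))) (CycSucc-gap srt c′ (proj₂ (CycSucc⇒∈ c)))))

  Arc-nested : ∀ {a b c d z} → 2 ≤ length t → CycSucc t d c → CycSucc t a b → ¬ (a ≡ d × b ≡ c) →
    Arc a b z → Arc c d z
  Arc-nested r≥2 dc ab ne (inj₁ refl)        = tile⊆Arc r≥2 dc (proj₁ (CycSucc⇒∈ ab))
  Arc-nested r≥2 dc ab ne (inj₂ (inj₁ refl)) = tile⊆Arc r≥2 dc (proj₂ (CycSucc⇒∈ ab))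
  Arc-nested {a} {b} {c} {d} {z} r≥2 dc ab ne (inj₂ (inj₂ azb)) with z ≟ c | z ≟ d
  ... | yes e | _ = inj₁ e
  ... | no _ | yes e = inj₂ (inj₁ e)
  ... | no z≢c | no z≢d with Cyclic-total {c} {z} {d} (z≢c ∘ sym) z≢d (CycSucc⇒≢ r≥2 dc ∘ sym)
  ...   | inj₁ czd = inj₂ (inj₂ czd)
  ...   | inj₂ cdz = ⊥-elim (ne (open-arcs-coincide azb (Cyclic-rotate cdz)
          (CycSucc-gap srt ab (proj₁ (CycSucc⇒∈ dc))) (CycSucc-gap srt ab (proj₂ (CycSucc⇒∈ dc)))
          (CycSucc-gap srt dc (proj₁ (CycSucc⇒∈ ab))) (CycSucc-gap srt dc (proj₂ (CycSucc⇒∈ ab)))))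

  side-Arcs-share-≤1 : ∀ {p q p′ q′} {s : List ℕ} → 3 ≤ length t →
    CycSucc t p q → CycSucc t p′ q′ → ¬ (p ≡ p′ × q ≡ q′) → Sorted s → 2 ≤ length s →
    (∀ {z} → z ∈ s → Arc p q z) → (∀ {z} → z ∈ s → Arc p′ q′ z) → ⊥
  side-Arcs-share-≤1 {s = _ ∷ []} _ _ _ _ _ (s≤s ()) _ _
  side-Arcs-share-≤1 {s = x₀ ∷ x₁ ∷ _} r≥3 c c′ ne ss _ h h′
    with side-Arcs-meet c c′ ne (h (here refl)) (h′ (here refl))
       | side-Arcs-meet c c′ ne (h (there (here refl))) (h′ (there (here refl)))
  ... | inj₁ (e₀ , _)  | inj₁ (e₁ , _)  = <-irrefl (trans e₀ (sym e₁)) (Linked.head ss)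
  ... | inj₂ (e₀ , _)  | inj₂ (e₁ , _)  = <-irrefl (trans e₀ (sym e₁)) (Linked.head ss)
  ... | inj₁ (e₀ , f₀) | inj₂ (e₁ , f₁) =
    no-2-cycle r≥3 c (subst₂ (CycSucc t) (trans (sym f₀) e₀) (trans (sym f₁) e₁) c′)
  ... | inj₂ (e₀ , f₀) | inj₁ (e₁ , f₁) =
    no-2-cycle r≥3 c (subst₂ (CycSucc t) (trans (sym f₁) e₁) (trans (sym f₀) e₀) c′)

SidesCross : ℕ → ℕ → ℕ → ℕ → Set
SidesCross p q p′ q′ = Cyclic p p′ q × Cyclic q q′ p

SidesCross-rotate : ∀ {p q p′ q′} → SidesCross p q p′ q′ → SidesCross p′ q′ q p
SidesCross-rotate (h₁ , h₂) =
  Cyclic-trans h₁ (Cyclic-rotate (Cyclic-rotate h₂)) , Cyclic-trans h₂ (Cyclic-rotate (Cyclic-rotate h₁))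

SidesCross-flip : ∀ {p q p′ q′} → SidesCross p q p′ q′ → SidesCross q p q′ p′
SidesCross-flip (h₁ , h₂) = h₂ , h₁

boundary-edge-gap : ∀ {n x y z} → BoundaryEdge n x y → z < n → ¬ Cyclic x z y
boundary-edge-gap (inj₁ (_ , refl))    _   (inj₁ (xz , zx))         = <-irrefl refl (<-≤-trans xz (≤-pred zx))
boundary-edge-gap (inj₁ (_ , refl))    _   (inj₂ (inj₁ (_ , sx)))   = <-irrefl refl (<-trans (n<1+n _) sx)
boundary-edge-gap (inj₁ (_ , refl))    _   (inj₂ (inj₂ (sx , _)))   = <-irrefl refl (<-trans (n<1+n _) sx)
boundary-edge-gap (inj₂ (_ , refl))    _   (inj₁ (_ , ()))
boundary-edge-gap (inj₂ (_ , refl))    _   (inj₂ (inj₁ (() , _)))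
boundary-edge-gap (inj₂ (refl , refl)) z<n (inj₂ (inj₂ (_ , xz))) = <-irrefl refl (<-≤-trans xz (≤-pred z<n))

AllPairs-lookup₂ : ∀ {A : Set} {R : A → A → Set} {xs x y} → AllPairs R xs → x ∈ xs → y ∈ xs →
  x ≡ y ⊎ R x y ⊎ R y x
AllPairs-lookup₂ (_ ∷ _)  (here refl) (here refl) = inj₁ refl
AllPairs-lookup₂ (h ∷ _)  (here refl) (there y∈)  = inj₂ (inj₁ (All.lookup h y∈))
AllPairs-lookup₂ (h ∷ _)  (there x∈)  (here refl) = inj₂ (inj₂ (All.lookup h x∈))
AllPairs-lookup₂ (_ ∷ hs) (there x∈)  (there y∈)  = AllPairs-lookup₂ hs x∈ y∈

SidesCross⇒DiagCross : ∀ {α β γ δ} → α < β → γ < δ → SidesCross α β γ δ → DiagCross (α , β) (γ , δ)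
SidesCross⇒DiagCross ab gd (inj₁ (ag , gb) , inj₁ (bd , da))        = ⊥-elim (<-asym ab (<-trans bd da))
SidesCross⇒DiagCross ab gd (inj₁ (ag , gb) , inj₂ (inj₁ (da , _)))  = ⊥-elim (<-asym ag (<-trans gd da))
SidesCross⇒DiagCross ab gd (inj₁ (ag , gb) , inj₂ (inj₂ (_ , bd)))  = inj₁ (ag , gb , bd)
SidesCross⇒DiagCross ab gd (inj₂ (inj₁ (_ , ba)) , _)               = ⊥-elim (<-asym ab ba)
SidesCross⇒DiagCross ab gd (inj₂ (inj₂ (ba , _)) , _)               = ⊥-elim (<-asym ab ba)

SidesCross⇒DiagCross′ : ∀ {α β γ δ} → α < β → γ < δ → SidesCross α β δ γ → DiagCross (α , β) (γ , δ)
SidesCross⇒DiagCross′ ab gd (inj₁ (ad , db) , inj₁ (bg , ga))        = ⊥-elim (<-asym db (<-trans bg gd))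
SidesCross⇒DiagCross′ ab gd (inj₁ (ad , db) , inj₂ (inj₁ (ga , _)))  = inj₂ (ga , ad , db)
SidesCross⇒DiagCross′ ab gd (inj₁ (ad , db) , inj₂ (inj₂ (_ , bg)))  = ⊥-elim (<-asym db (<-trans bg gd))
SidesCross⇒DiagCross′ ab gd (inj₂ (inj₁ (_ , ba)) , _)               = ⊥-elim (<-asym ab ba)
SidesCross⇒DiagCross′ ab gd (inj₂ (inj₂ (ba , _)) , _)               = ⊥-elim (<-asym ab ba)

DiagCross-sym : ∀ {d e} → DiagCross d e → DiagCross e d
DiagCross-sym (inj₁ x) = inj₂ x
DiagCross-sym (inj₂ y) = inj₁ y

DiagCross-irrefl : ∀ {d} → ¬ DiagCross d d
DiagCross-irrefl (inj₁ (x , _)) = <-irrefl refl x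
DiagCross-irrefl (inj₂ (x , _)) = <-irrefl refl x

IsTile-≥2 : ∀ {n} {T : Tiling n} {t} → IsTile T t → 2 ≤ length t
IsTile-≥2 Tt = ≤-trans (n≤1+n 2) (IsTile.atLeast3 Tt)

IsTile-bounded : ∀ {n} {T : Tiling n} {t z} → IsTile T t → z ∈ t → z < n
IsTile-bounded Tt = All.lookup (IsTile.bounded Tt)

module _ {n : ℕ} (T : Tiling n) where

  diag-ordered : ∀ {a b} → (a , b) ∈ diags T → a < b
  diag-ordered d∈ = <-trans (n<1+n _) (proj₁ (All.lookup (diags-valid T) d∈))

  diags-noncrossing : ∀ {d e} → d ∈ diags T → e ∈ diags T → ¬ DiagCross d e
  diags-noncrossing d∈ e∈ dc with AllPairs-lookup₂ (diags-compatible T) d∈ e∈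
  ... | inj₁ refl             = DiagCross-irrefl dc
  ... | inj₂ (inj₁ (_ , nc)) = nc dc
  ... | inj₂ (inj₂ (_ , nc)) = nc (DiagCross-sym dc)

  diagsOf-noncrossing : ∀ {p q p′ q′} → IsDiagOf T p q → IsDiagOf T p′ q′ → ¬ SidesCross p q p′ q′
  diagsOf-noncrossing (inj₁ d∈) (inj₁ e∈) X =
    diags-noncrossing d∈ e∈ (SidesCross⇒DiagCross (diag-ordered d∈) (diag-ordered e∈) X)
  diagsOf-noncrossing (inj₁ d∈) (inj₂ e∈) X =
    diags-noncrossing d∈ e∈ (SidesCross⇒DiagCross′ (diag-ordered d∈) (diag-ordered e∈) X)
  diagsOf-noncrossing (inj₂ d∈) (inj₁ e∈) X =
    diags-noncrossing d∈ e∈ (SidesCross⇒DiagCross′ (diag-ordered d∈) (diag-ordered e∈) (SidesCross-flip X))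
  diagsOf-noncrossing (inj₂ d∈) (inj₂ e∈) X =
    diags-noncrossing d∈ e∈ (SidesCross⇒DiagCross (diag-ordered d∈) (diag-ordered e∈) (SidesCross-flip X))

  edges-noncrossing : ∀ {p q p′ q′} → IsEdgeOf T p q → IsEdgeOf T p′ q′ → p′ < n → q < n →
    ¬ SidesCross p q p′ q′
  edges-noncrossing (inj₁ be) _          p′<n q<n X = boundary-edge-gap be p′<n (proj₁ X)
  edges-noncrossing (inj₂ _)  (inj₁ be)  p′<n q<n X = boundary-edge-gap be q<n (proj₁ (SidesCross-rotate X))
  edges-noncrossing (inj₂ d)  (inj₂ d′)  p′<n q<n X = diagsOf-noncrossing d d′ X

  -- If t and t′ share the side [a , b] and t turned at b before t′ does, the side [b , c′] of t′ would cut
  -- through t: either c′ is a vertex of t, contradicting noInnerDiag, or it lies beyond a side of t it crosses.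
  private
    turn-earlier-impossible : ∀ {t t′ a b c c′} → IsTile T t → IsTile T t′ →
      CycSucc t a b → CycSucc t′ a b → CycSucc t b c → CycSucc t′ b c′ → ¬ Cyclic b c c′
    turn-earlier-impossible {t} {t′} {a} {b} {c} {c′} Tt Tt′ ab ab′ bc bc′ bcc′ with c′ ∈? t
    ... | yes c′∈ with IsTile.sidesEdges Tt′ bc′
    ...   | inj₁ be = boundary-edge-gap be (IsTile-bounded Tt (proj₂ (CycSucc⇒∈ bc))) bcc′
    ...   | inj₂ d with IsTile.noInnerDiag Tt (proj₁ (CycSucc⇒∈ bc)) c′∈ d
    ...     | inj₁ bc″ = Cyclic⇒≢₂₃ bcc′ (succ-unique (IsTile.increasing Tt) bc bc″)
    ...     | inj₂ c′b with pred-unique (IsTile.increasing Tt) c′b ab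
    ...       | refl = no-2-cycle (IsTile.increasing Tt′) (IsTile.atLeast3 Tt′) ab′ bc′
    turn-earlier-impossible {t} {t′} {a} {b} {c} {c′} Tt Tt′ ab ab′ bc bc′ bcc′ | no c′∉
      with ∉⇒inside-side (IsTile.increasing Tt) (IsTile-≥2 Tt) c′∉
    ... | s , s′ , ss′ , sc′s′ =
      edges-noncrossing (IsTile.sidesEdges Tt′ bc′) (IsTile.sidesEdges Tt ss′)
        (IsTile-bounded Tt (proj₁ (CycSucc⇒∈ ss′))) (IsTile-bounded Tt′ (proj₂ (CycSucc⇒∈ bc′)))
        (proj₂ X , proj₁ X)
      where
      st = IsTile.increasing Tt
      b≢s : b ≢ s
      b≢s refl = Cyclic-asym bcc′ (subst (λ w → Cyclic b c′ w) (sym (succ-unique st bc ss′)) sc′s′)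
      b≢s′ : b ≢ s′
      b≢s′ refl = CycSucc-gap (IsTile.increasing Tt′) ab′ (proj₂ (CycSucc⇒∈ bc′))
                    (subst (λ w → Cyclic w c′ b) (pred-unique st ss′ ab) sc′s′)
      s′bs : Cyclic s′ b s
      s′bs with Arc-complement (CycSucc⇒≢ st (IsTile-≥2 Tt) ss′ ∘ sym) (CycSucc-gap st ss′ (proj₂ (CycSucc⇒∈ ab)))
      ... | inj₁ e         = ⊥-elim (b≢s′ e)
      ... | inj₂ (inj₁ e)  = ⊥-elim (b≢s e)
      ... | inj₂ (inj₂ h)  = h
      X : SidesCross c′ b s′ s
      X = SidesCross-rotate (sc′s′ , s′bs)

  shared-side-turn-unique : ∀ {t t′ a b c c′} → IsTile T t → IsTile T t′ →
    CycSucc t a b → CycSucc t′ a b → CycSucc t b c → CycSucc t′ b c′ → c ≡ c′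
  shared-side-turn-unique {c = c} {c′} Tt Tt′ ab ab′ bc bc′ with c ≟ c′
  ... | yes e = e
  ... | no c≢c′ with Cyclic-total (CycSucc⇒≢ (IsTile.increasing Tt) (IsTile-≥2 Tt) bc) c≢c′
                                   (CycSucc⇒≢ (IsTile.increasing Tt′) (IsTile-≥2 Tt′) bc′)
  ...   | inj₁ h = ⊥-elim (turn-earlier-impossible Tt Tt′ ab ab′ bc bc′ h)
  ...   | inj₂ h = ⊥-elim (turn-earlier-impossible Tt′ Tt ab′ ab bc′ bc h)

-- Rank of z in the clockwise walk starting at b (not the true distance: vertices before b are shifted by n).
cw-rank : ℕ → ℕ → ℕ → ℕ
cw-rank n b z with b ≤? z
... | yes _ = z ∸ b
... | no _  = z + n

cw-rank-self : ∀ n b → cw-rank n b b ≡ 0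
cw-rank-self n b with b ≤? b
... | yes _   = n∸n≡0 b
... | no b≰b = ⊥-elim (b≰b ≤-refl)

cw-rank-pos : ∀ {n b z} → z ≢ b → z < n → 0 < cw-rank n b z
cw-rank-pos {n} {b} {z} z≢b z<n with b ≤? z
... | yes b≤z = m<n⇒0<n∸m (≤∧≢⇒< b≤z (z≢b ∘ sym))
... | no _    = <-≤-trans (≤-trans (s≤s z≤n) z<n) (m≤n+m n z)

cw-rank-mono : ∀ {n b p z} → p < n → z < n → Cyclic b p z → cw-rank n b p < cw-rank n b z
cw-rank-mono {n} {b} {p} {z} p<n z<n h with b ≤? p | b ≤? z | h
... | yes _   | yes _   | inj₁ (bp , pz)        = ∸-monoˡ-< pz (<⇒≤ bp)
... | yes b≤p | _       | inj₂ (inj₁ (pz , zb)) = ⊥-elim (<-irrefl refl (<-≤-trans (<-trans pz zb) b≤p))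
... | yes _   | yes b≤z | inj₂ (inj₂ (zb , _))  = ⊥-elim (<-irrefl refl (<-≤-trans zb b≤z))
... | yes _   | no _    | inj₂ (inj₂ _)         = <-≤-trans (≤-<-trans (m∸n≤m p b) p<n) (m≤n+m n z)
... | no b≰p  | _       | inj₁ (bp , _)         = ⊥-elim (b≰p (<⇒≤ bp))
... | yes _   | no b≰z  | inj₁ (bp , pz)        = ⊥-elim (b≰z (<⇒≤ (<-trans bp pz)))
... | no _    | yes b≤z | inj₂ (inj₁ (_ , zb))  = ⊥-elim (<-irrefl refl (<-≤-trans zb b≤z))
... | no _    | no _    | inj₂ (inj₁ (pz , _))  = +-monoˡ-< n pz
... | no b≰p  | _       | inj₂ (inj₂ (_ , bp))  = ⊥-elim (b≰p (<⇒≤ bp))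

module _ {n : ℕ} (T : Tiling n) {t t′ : List ℕ} (Tt : IsTile T t) (Tt′ : IsTile T t′) where

  private
    st = IsTile.increasing Tt

  -- Walking backwards from z towards b, each vertex of t is a vertex of t′ with the same predecessor,
  -- since t and t′ turn the same way at every shared side.
  shared-side⇒⊆ : ∀ {a b} → CycSucc t a b → CycSucc t′ a b → ∀ fuel z → cw-rank n b z < fuel → z ∈ t →
    z ∈ t′ × (∀ {p} → CycSucc t p z → CycSucc t′ p z)
  shared-side⇒⊆ _ _ zero _ () _
  shared-side⇒⊆ {a} {b} ab ab′ (suc f) z lt z∈ with z ≟ b
  ... | yes refl = proj₂ (CycSucc⇒∈ ab′) , λ pz → subst (λ w → CycSucc t′ w z) (pred-unique st ab pz) ab′
  shared-side⇒⊆ {a} {b} ab ab′ (suc f) z lt z∈ | no z≢b with CycSucc-pred {t} z∈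
  ... | p , pz with shared-side⇒⊆ ab ab′ f p (≤-trans rank< (≤-pred lt)) (proj₁ (CycSucc⇒∈ pz))
                  | CycSucc-pred {t} (proj₁ (CycSucc⇒∈ pz))
    where
    rank< : cw-rank n b p < cw-rank n b z
    rank< with p ≟ b
    ... | yes refl = subst (_< cw-rank n b z) (sym (cw-rank-self n b)) (cw-rank-pos z≢b (IsTile-bounded Tt z∈))
    ... | no p≢b with Arc-complement {z} {p} (CycSucc⇒≢ st (IsTile-≥2 Tt) pz ∘ sym) (CycSucc-gap st pz (proj₂ (CycSucc⇒∈ ab)))
    ...   | inj₁ e        = ⊥-elim (z≢b (sym e))
    ...   | inj₂ (inj₁ e) = ⊥-elim (p≢b (sym e))
    ...   | inj₂ (inj₂ h) = cw-rank-mono (IsTile-bounded Tt (proj₁ (CycSucc⇒∈ pz))) (IsTile-bounded Tt z∈) (Cyclic-rotate h)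
  ... | p∈′ , pred′ | q , qp with CycSucc-succ {t′} p∈′
  ... | z′ , pz′ with shared-side-turn-unique T Tt Tt′ qp (pred′ qp) pz pz′
  ... | refl = proj₂ (CycSucc⇒∈ pz′) , λ p′z → subst (λ w → CycSucc t′ w z) (pred-unique st pz p′z) pz′

tile-unique : ∀ {n} (T : Tiling n) {t t′ a b} → IsTile T t → IsTile T t′ →
  CycSucc t a b → CycSucc t′ a b → t ≡ t′
tile-unique {n} T {b = b} Tt Tt′ ab ab′ =
  sorted-≡ (IsTile.increasing Tt) (IsTile.increasing Tt′)
    (λ {z} z∈ → proj₁ (shared-side⇒⊆ T Tt Tt′ ab ab′ (suc (cw-rank n b z)) z ≤-refl z∈))
    (λ {z} z∈ → proj₁ (shared-side⇒⊆ T Tt′ Tt ab′ ab (suc (cw-rank n b z)) z ≤-refl z∈))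

private
  3*-step : ∀ {a b} → a < b → 3 * a + 3 ≤ 3 * b
  3*-step {a} {b} a<b = subst (_≤ 3 * b) (trans (*-suc 3 a) (+-comm 3 (3 * a))) (*-monoʳ-≤ 3 a<b)

  3a<3b⇒a<b : ∀ {a b} → 3 * a < 3 * b → a < b
  3a<3b⇒a<b {a} {b} = *-cancelˡ-< 3 a b

  3a+2<3b+2⇒a<b : ∀ {a b} → 3 * a + 2 < 3 * b + 2 → a < b
  3a+2<3b+2⇒a<b {a} {b} = 3a<3b⇒a<b ∘ +-cancelʳ-< 2 (3 * a) (3 * b)

  3a<3b+2⇒a≤b : ∀ {a b} → 3 * a < 3 * b + 2 → a ≤ b
  3a<3b+2⇒a≤b {a} {b} h = ≮⇒≥ λ b<a → 4≰2 (+-cancelˡ-≤ (3 * b) 4 2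
    (subst (_≤ 3 * b + 2) (sym (+-suc (3 * b) 3)) (≤-trans (s≤s (3*-step b<a)) h)))
    where
    4≰2 : ¬ (4 ≤ 2)
    4≰2 (s≤s (s≤s ()))

  3a+2<3b⇒a<b : ∀ {a b} → 3 * a + 2 < 3 * b → a < b
  3a+2<3b⇒a<b {a} {b} h = ≰⇒> λ b≤a → 3≰0 (+-cancelˡ-≤ (3 * a) 3 0
    (subst₂ _≤_ (sym (+-suc (3 * a) 2)) (sym (+-identityʳ (3 * a))) (≤-trans h (*-monoʳ-≤ 3 b≤a))))
    where
    3≰0 : ¬ (3 ≤ 0)
    3≰0 ()

  a<b⇒3a<3b : ∀ {a b} → a < b → 3 * a < 3 * b
  a<b⇒3a<3b = *-monoʳ-< 3

  a<b⇒3a+2<3b+2 : ∀ {a b} → a < b → 3 * a + 2 < 3 * b + 2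
  a<b⇒3a+2<3b+2 = +-monoˡ-< 2 ∘ a<b⇒3a<3b

  a<b⇒3a+2<3b : ∀ {a b} → a < b → 3 * a + 2 < 3 * b
  a<b⇒3a+2<3b {a} a<b = <-≤-trans (+-monoʳ-< (3 * a) (s≤s (s≤s (s≤s z≤n)))) (3*-step a<b)

  exactly-one : ∀ {A B : Set} → (A × ¬ B) ⊎ (¬ A × B) → ¬ A → ¬ B → ⊥
  exactly-one (inj₁ (a , _)) ¬a _  = ¬a a
  exactly-one (inj₂ (_ , b)) _  ¬b = ¬b b

  not-both : ∀ {A B : Set} → (A × ¬ B) ⊎ (¬ A × B) → A → B → ⊥
  not-both (inj₁ (_ , ¬b)) _ b = ¬b b
  not-both (inj₂ (¬a , _)) a _ = ¬a a

-- On the boundary of a tile with r vertices, the segment parallel to the side [j , j′] runs from 3 j′ + 2 to 3 j.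
segment-chords-cross⇒adjacent : ∀ {r j j′ l l′} → j < r → l < r → CycStep r j j′ → CycStep r l l′ →
  ChordsCross (3 * j) (3 * j′ + 2) (3 * l) (3 * l′ + 2) → l ≡ j′ ⊎ j ≡ l′
segment-chords-cross⇒adjacent {r} {j} {j′} {l} {l′} j<r l<r sj sl cc with l ≟ j′ | j ≟ l′
... | yes e | _     = inj₁ e
... | no _  | yes e = inj₂ e
... | no l≢j′ | no j≢l′ = ⊥-elim (impossible sj sl cc)
  where
  j≢l : j ≢ l
  j≢l refl = proj₁ (proj₁ cc) refl
  impossible : CycStep r j j′ → CycStep r l l′ → ¬ ChordsCross (3 * j) (3 * j′ + 2) (3 * l) (3 * l′ + 2)
  impossible (inj₁ refl) _ (_ , x) = exactly-one x ¬c ¬d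
    where
    ¬c : ¬ StrictlyBetween (3 * j) (3 * suc j + 2) (3 * l)
    ¬c (inj₁ (a , b)) = l≢j′ (≤-antisym (3a<3b+2⇒a≤b {l} {suc j} b) (3a<3b⇒a<b {j} {l} a))
    ¬c (inj₂ (a , b)) = <-asym (3a+2<3b⇒a<b {suc j} {l} a) (<-trans (3a<3b⇒a<b {l} {j} b) (n<1+n j))
    ¬d : ¬ StrictlyBetween (3 * j) (3 * suc j + 2) (3 * l′ + 2)
    ¬d (inj₁ (a , b)) = j≢l′ (≤-antisym (3a<3b+2⇒a≤b {j} {l′} a) (≤-pred (3a+2<3b+2⇒a<b {l′} {suc j} b)))
    ¬d (inj₂ (a , b)) = <-asym (3a+2<3b+2⇒a<b {suc j} {l′} a) (<-trans (3a+2<3b⇒a<b {l′} {j} b) (n<1+n j))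
  impossible (inj₂ (refl , refl)) (inj₂ (e , refl)) _ = j≢l (suc-injective (sym e))
  impossible (inj₂ (refl , refl)) (inj₁ refl) (_ , x) = not-both x c d
    where
    0<l : 0 < l
    0<l = ≤∧≢⇒< z≤n (l≢j′ ∘ sym)
    l<j : l < j
    l<j = ≤∧≢⇒< (≤-pred l<r) (j≢l ∘ sym)
    1+l<j : suc l < j
    1+l<j = ≤∧≢⇒< l<j (j≢l′ ∘ sym)
    c : StrictlyBetween (3 * j) 2 (3 * l)
    c = inj₂ (a<b⇒3a+2<3b 0<l , a<b⇒3a<3b l<j)
    d : StrictlyBetween (3 * j) 2 (3 * suc l + 2)
    d = inj₂ (a<b⇒3a+2<3b+2 (s≤s z≤n) , a<b⇒3a+2<3b 1+l<j)

SegCross⇒adjacent : ∀ {n} {T : Tiling n} {s s′} → IsSeg T s → IsSeg T s′ → SegCross s s′ →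
  u s′ ≡ v s ⊎ u s ≡ v s′
SegCross⇒adjacent {s = seg t a b} {seg .t c d} (Tt , ab) (_ , cd) (refl , cc)
  with segment-chords-cross⇒adjacent (idxOf<length st (proj₁ (CycSucc⇒∈ ab))) (idxOf<length st (proj₁ (CycSucc⇒∈ cd)))
         (CycSucc⇒CycStep st ab) (CycSucc⇒CycStep st cd) cc
  where st = IsTile.increasing Tt
... | inj₁ e = inj₁ (idxOf-injective (IsTile.increasing Tt) (proj₁ (CycSucc⇒∈ cd)) (proj₂ (CycSucc⇒∈ ab)) e)
... | inj₂ e = inj₂ (idxOf-injective (IsTile.increasing Tt) (proj₁ (CycSucc⇒∈ ab)) (proj₂ (CycSucc⇒∈ cd)) e)

ChordsCross? : ∀ a b c d → Dec (ChordsCross a b c d)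
ChordsCross? a b c d = (¬? (a ≟ c) ×-dec (¬? (a ≟ d) ×-dec (¬? (b ≟ c) ×-dec ¬? (b ≟ d)))) ×-dec
  ((between? c ×-dec ¬? (between? d)) ⊎-dec (¬? (between? c) ×-dec between? d))
  where
  between? : ∀ x → Dec (StrictlyBetween a b x)
  between? x = (a <? x ×-dec x <? b) ⊎-dec (b <? x ×-dec x <? a)

triangle-segments-cross : ∀ {n} {T : Tiling n} {t w x y} → IsTile T t → length t ≡ 3 →
  CycSucc t w x → CycSucc t x y → CycSucc t y w → SegCross (seg t w x) (seg t y w)
triangle-segments-cross {t = t} {w} {x} {y} Tt t≡3 wx xy yw = refl , positions
  where
  st = IsTile.increasing Tt
  x≡next = CycStep⇒next (idxOf<length st (proj₂ (CycSucc⇒∈ wx))) (CycSucc⇒CycStep st wx)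
  y≡next = CycStep⇒next (idxOf<length st (proj₂ (CycSucc⇒∈ xy))) (CycSucc⇒CycStep st xy)
  w<3 = subst (idxOf t w <_) t≡3 (idxOf<length st (proj₁ (CycSucc⇒∈ wx)))
  by-cases : ∀ i → i < 3 → ChordsCross (3 * i) (3 * next 3 i + 2) (3 * next 3 (next 3 i)) (3 * i + 2)
  by-cases 0 _ = toWitness {a? = ChordsCross? 0 5 6 2} _
  by-cases 1 _ = toWitness {a? = ChordsCross? 3 8 0 5} _
  by-cases 2 _ = toWitness {a? = ChordsCross? 6 2 3 8} _
  by-cases (suc (suc (suc i))) (s≤s (s≤s (s≤s ())))
  positions : ChordsCross (3 * idxOf t w) (3 * idxOf t x + 2) (3 * idxOf t y) (3 * idxOf t w + 2)
  positions rewrite y≡next | x≡next | t≡3 = by-cases (idxOf t w) w<3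

module _ {A : Set} {R : A → A → Set} where

  Linked-lookup-adjacent : ∀ {xs} → Linked R xs → (i j : Fin (length xs)) →
    toℕ j ≡ suc (toℕ i) → R (lookup xs i) (lookup xs j)
  Linked-lookup-adjacent [-]     Fin.zero    Fin.zero             ()
  Linked-lookup-adjacent (r ∷ _) Fin.zero    Fin.zero             ()
  Linked-lookup-adjacent (r ∷ _) Fin.zero    (Fin.suc Fin.zero)    _ = r
  Linked-lookup-adjacent (r ∷ _) Fin.zero    (Fin.suc (Fin.suc j)) ()
  Linked-lookup-adjacent (r ∷ _) (Fin.suc i) Fin.zero             ()
  Linked-lookup-adjacent (r ∷ l) (Fin.suc i) (Fin.suc j)          e = Linked-lookup-adjacent l i j (suc-injective e)

  Linked-propagate-forward : ∀ {P : A → Set} {xs} → Linked R xs → (∀ {x y} → P x → R x y → P y) →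
    (i j : Fin (length xs)) → toℕ i ≤ toℕ j → P (lookup xs i) → P (lookup xs j)
  Linked-propagate-forward [-]     _    Fin.zero    Fin.zero    _        p = p
  Linked-propagate-forward (r ∷ l) _    Fin.zero    Fin.zero    _        p = p
  Linked-propagate-forward (r ∷ l) pres Fin.zero    (Fin.suc j) _        p =
    Linked-propagate-forward l pres Fin.zero j z≤n (pres p r)
  Linked-propagate-forward (r ∷ l) pres (Fin.suc i) (Fin.suc j) (s≤s le) p = Linked-propagate-forward l pres i j le p

  Linked-propagate-backward : ∀ {P : A → Set} {xs} → Linked R xs → (∀ {x y} → R x y → P y → P x) →
    (i j : Fin (length xs)) → toℕ j ≤ toℕ i → P (lookup xs i) → P (lookup xs j)
  Linked-propagate-backward [-]     _    Fin.zero    Fin.zero    _        p = p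
  Linked-propagate-backward (r ∷ l) _    Fin.zero    Fin.zero    _        p = p
  Linked-propagate-backward (r ∷ l) pres (Fin.suc i) Fin.zero    _        p =
    pres r (Linked-propagate-backward l pres i Fin.zero z≤n p)
  Linked-propagate-backward (r ∷ l) pres (Fin.suc i) (Fin.suc j) (s≤s le) p = Linked-propagate-backward l pres i j le p

  Linked-with-All : ∀ {P : A → Set} {xs} → All P xs → Linked R xs → Linked (λ x y → P x × P y × R x y) xs
  Linked-with-All []           []      = []
  Linked-with-All (p ∷ [])     [-]     = [-]
  Linked-with-All (p ∷ q ∷ ps) (r ∷ l) = (p , q , r) ∷ Linked-with-All (q ∷ ps) l

Fin-pred : ∀ {m} (j : Fin m) → 0 < toℕ j → Σ (Fin m) λ j′ → toℕ j ≡ suc (toℕ j′)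
Fin-pred j 0<j = fromℕ< (≤-<-trans (m∸n≤m (toℕ j) 1) (toℕ<n j)) ,
  trans (sym (m+[n∸m]≡n {1} {toℕ j} 0<j)) (cong suc (sym (toℕ-fromℕ< _)))

Fin-succ : ∀ {m} (i j : Fin m) → toℕ i < toℕ j → Σ (Fin m) λ i′ → toℕ i′ ≡ suc (toℕ i)
Fin-succ i j i<j = fromℕ< (≤-<-trans i<j (toℕ<n j)) , toℕ-fromℕ< _

-- Strands stay on the far side of every edge they cross

module _ {n : ℕ} (T : Tiling n) where

  strand-seg : ∀ {S} → IsStrand T S → (i : Fin (length S)) → IsSeg T (lookup S i)
  strand-seg HS i = All.lookup (proj₁ HS) (∈-lookup i)

  LeavesThrough-unique : ∀ {s a b a′ b′} → IsSeg T s → LeavesThrough s a b → LeavesThrough s a′ b′ →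
    a ≡ a′ × b ≡ b′
  LeavesThrough-unique h (c , refl) (c′ , refl) = pred-unique (IsTile.increasing (proj₁ h)) c c′ , refl

  EntersThrough-unique : ∀ {s a b a′ b′} → IsSeg T s → EntersThrough s a b → EntersThrough s a′ b′ →
    a ≡ a′ × b ≡ b′
  EntersThrough-unique h (c , refl) (c′ , refl) = refl , succ-unique (IsTile.increasing (proj₁ h)) c c′

  enter≢leave : ∀ {s p q a b} → IsSeg T s → EntersThrough s p q → LeavesThrough s a b → ¬ (p ≡ a × q ≡ b)
  enter≢leave (Tt , uv) (_ , refl) (ab , refl) (refl , refl) =
    no-2-cycle (IsTile.increasing Tt) (IsTile.atLeast3 Tt) ab uv

  ContinuesWithin : Seg → Seg → Set
  ContinuesWithin x y = IsSeg T x × IsSeg T y × Continues T x y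

  module Confinement {S : List Seg} (HS : IsStrand T S) where

    private
      linked : Linked ContinuesWithin S
      linked = Linked-with-All (proj₁ HS) (proj₁ (proj₂ HS))

    BeyondExit : ℕ → ℕ → Seg → Set
    BeyondExit a b s = ∀ {a′ b′} → LeavesThrough s a′ b′ → ∀ {z} → Arc a′ b′ z → Arc a b z

    BeyondEntry : ℕ → ℕ → Seg → Set
    BeyondEntry a b s = ∀ {p q} → EntersThrough s p q → ∀ {z} → Arc p q z → Arc a b z

    BeyondExit-step : ∀ {a b x y} → BeyondExit a b x → ContinuesWithin x y → BeyondExit a b y
    BeyondExit-step beyond (hx , hy@(Ty , _) , _ , _ , lx , ey , _) ly az =
      beyond lx (Arc-nested (IsTile.increasing Ty) (IsTile-≥2 Ty) (proj₁ ey) (proj₁ ly)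
                  (λ { (e₁ , e₂) → enter≢leave hy ey ly (sym e₁ , sym e₂) }) az)

    BeyondEntry-step : ∀ {a b x y} → ContinuesWithin x y → BeyondEntry a b y → BeyondEntry a b x
    BeyondEntry-step (hx@(Tx , _) , hy , _ , _ , lx , ey , _) beyond ex az =
      beyond ey (Arc-nested (IsTile.increasing Tx) (IsTile-≥2 Tx) (proj₁ lx) (proj₁ ex) (enter≢leave hx ex lx) az)

    after-exit⊆Arc : ∀ (i j : Fin (length S)) → toℕ i < toℕ j → ∀ {a b} → LeavesThrough (lookup S i) a b →
      ∀ {z} → z ∈ tile (lookup S j) → Arc a b z
    after-exit⊆Arc i j i<j {a} {b} exit z∈ with Fin-pred j (≤-trans (s≤s z≤n) i<j)
    ... | j′ , j≡ with Linked-lookup-adjacent linked j′ j j≡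
    ... | _ , (Tj , _) , _ , _ , lx , ey , _ =
      beyond-j′ lx (tile⊆Arc (IsTile.increasing Tj) (IsTile-≥2 Tj) (proj₁ ey) z∈)
      where
      beyond-i : BeyondExit a b (lookup S i)
      beyond-i exit′ az with LeavesThrough-unique (strand-seg HS i) exit exit′
      ... | refl , refl = az
      beyond-j′ : BeyondExit a b (lookup S j′)
      beyond-j′ = Linked-propagate-forward {P = BeyondExit a b} linked BeyondExit-step i j′
                    (≤-pred (subst (toℕ i <_) j≡ i<j)) beyond-i

    before-entry⊆Arc : ∀ (i j : Fin (length S)) → toℕ j < toℕ i → ∀ {a b} → EntersThrough (lookup S i) a b →
      ∀ {z} → z ∈ tile (lookup S j) → Arc a b z
    before-entry⊆Arc i j j<i {a} {b} entry z∈ with Fin-succ j i j<i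
    ... | j′ , j′≡ with Linked-lookup-adjacent linked j j′ j′≡
    ... | (Tj , _) , _ , _ , _ , lx , ey , _ =
      beyond-j′ ey (tile⊆Arc (IsTile.increasing Tj) (IsTile-≥2 Tj) (proj₁ lx) z∈)
      where
      beyond-i : BeyondEntry a b (lookup S i)
      beyond-i entry′ az with EntersThrough-unique (strand-seg HS i) entry entry′
      ... | refl , refl = az
      beyond-j′ : BeyondEntry a b (lookup S j′)
      beyond-j′ = Linked-propagate-backward {P = BeyondEntry a b} linked BeyondEntry-step i j′
                    (subst (_≤ toℕ i) (sym j′≡) j<i) beyond-i

module LeavingTile {n : ℕ} (T : Tiling n) {S S′ : List Seg} (HS : IsStrand T S) (HS′ : IsStrand T S′)
  {t : List ℕ} (Tt : IsTile T t) (i : Fin (length S)) (k : Fin (length S′))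
  (tS : tile (lookup S i) ≡ t) (tS′ : tile (lookup S′ k) ≡ t)
  {pa pb qa qb : ℕ} (exit : LeavesThrough (lookup S i) pa pb) (entry : EntersThrough (lookup S′ k) qa qb) where

  private
    st = IsTile.increasing Tt
    r≥3 = IsTile.atLeast3 Tt
    open Confinement T HS  using (after-exit⊆Arc)
    open Confinement T HS′ using (before-entry⊆Arc)

    pa→pb : CycSucc t pa pb
    pa→pb = subst (λ w → CycSucc w pa pb) tS (proj₁ exit)
    qa→qb : CycSucc t qa qb
    qa→qb = subst (λ w → CycSucc w qa qb) tS′ (proj₁ entry)

  -- Neither strand can return alone to t, so any later common tile is met strictly later by both.
  common-tile-later : ∀ (i′ : Fin (length S)) (k′ : Fin (length S′)) → toℕ i ≤ toℕ i′ → toℕ k′ ≤ toℕ k →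
    tile (lookup S i′) ≡ tile (lookup S′ k′) →
    (toℕ i′ ≡ toℕ i × toℕ k′ ≡ toℕ k) ⊎ (toℕ i < toℕ i′ × toℕ k′ < toℕ k)
  common-tile-later i′ k′ i≤i′ k′≤k same with m≤n⇒m<n∨m≡n i≤i′ | m≤n⇒m<n∨m≡n k′≤k
  ... | inj₂ e₁ | inj₂ e₂ = inj₁ (sym e₁ , e₂)
  ... | inj₁ l₁ | inj₁ l₂ = inj₂ (l₁ , l₂)
  ... | inj₂ e₁ | inj₁ l₂ = ⊥-elim (tile⊈side-Arc st r≥3 qa→qb λ {z} z∈ →
          before-entry⊆Arc k k′ l₂ entry (subst (z ∈_) t≡ z∈))
    where
    t≡ : t ≡ tile (lookup S′ k′)
    t≡ = trans (sym tS) (trans (cong (λ j → tile (lookup S j)) (toℕ-injective e₁)) same)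
  ... | inj₁ l₁ | inj₂ e₂ = ⊥-elim (tile⊈side-Arc st r≥3 pa→pb λ {z} z∈ →
          after-exit⊆Arc i i′ l₁ exit (subst (z ∈_) t≡ z∈))
    where
    t≡ : t ≡ tile (lookup S i′)
    t≡ = trans (sym tS′) (trans (cong (λ j → tile (lookup S′ j)) (toℕ-injective (sym e₂))) (sym same))

  separate-sides⇒no-common-tile : ¬ (pa ≡ qa × pb ≡ qb) →
    ∀ (i′ : Fin (length S)) (k′ : Fin (length S′)) → toℕ i ≤ toℕ i′ → toℕ k′ ≤ toℕ k →
    tile (lookup S i′) ≡ tile (lookup S′ k′) → toℕ i′ ≡ toℕ i × toℕ k′ ≡ toℕ k
  separate-sides⇒no-common-tile sides≢ i′ k′ i≤i′ k′≤k same with common-tile-later i′ k′ i≤i′ k′≤k same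
  ... | inj₁ here′ = here′
  ... | inj₂ (l₁ , l₂) = ⊥-elim (side-Arcs-share-≤1 st r≥3 pa→pb qa→qb sides≢
          (IsTile.increasing Ti′) (IsTile-≥2 Ti′)
          (after-exit⊆Arc i i′ l₁ exit) (λ {z} z∈ → before-entry⊆Arc k k′ l₂ entry (subst (z ∈_) same z∈)))
    where Ti′ = proj₁ (strand-seg T HS i′)

-- What SegCross implies, by SegCross⇒adjacent; it is all the argument below uses of a crossing.
AdjacentInTile : Seg → Seg → Set
AdjacentInTile s s′ = tile s ≡ tile s′ × (u s′ ≡ v s ⊎ u s ≡ v s′)

AdjacentInTile-sym : ∀ {s s′} → AdjacentInTile s s′ → AdjacentInTile s′ s
AdjacentInTile-sym (e , inj₁ x) = sym e , inj₂ x
AdjacentInTile-sym (e , inj₂ y) = sym e , inj₁ y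

-- Part (I)

module _ {n : ℕ} (T : Tiling n) {t : List ℕ} (Tt : IsTile T t) {x y w z : ℕ}
  (xy : CycSucc t x y) (wx : CycSucc t w x) (yz : CycSucc t y z) where

  private
    st = IsTile.increasing Tt
    r≥3 = IsTile.atLeast3 Tt
    r≥2 = IsTile-≥2 Tt

  quadrilateral-opposite-side : length t ≡ 4 →
    ∃₂ λ c d → CycSucc t y c × CycSucc t c d × CycSucc t d x ×
      LeavesThrough (seg t w x) c d × EntersThrough (seg t y z) c d
  quadrilateral-opposite-side t≡4 with CycSucc-succ {t} (proj₂ (CycSucc⇒∈ yz))
  ... | f , zf with quadrilateral-closes st t≡4 wx xy yz zf
  ... | refl = z , w , yz , zf , wx , (zf , refl) , (zf , refl)

  triangle-facing-segments-cross : length t ≡ 3 → SegCross (seg t w x) (seg t y z)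
  triangle-facing-segments-cross t≡3 =
    subst (λ q → SegCross (seg t w x) (seg t y q)) (sym z≡w) (triangle-segments-cross Tt t≡3 wx xy yw)
    where
    z≡w : z ≡ w
    z≡w = triangle-closes st t≡3 wx xy yz
    yw : CycSucc t y w
    yw = subst (CycSucc t y) z≡w yz

  large-tile-different-sides : 4 < length t →
    ∀ a b c d → LeavesThrough (seg t w x) a b → EntersThrough (seg t y z) c d → ¬ (a ≡ c × b ≡ d)
  large-tile-different-sides 4<r a b c d (ab , w≡b) (cd , z≡c) (refl , refl) =
    <-irrefl (sym (4-cycle⇒quadrilateral st r≥3 wx xy yz (subst₂ (CycSucc t) (sym z≡c) (sym w≡b) ab))) 4<r

  module _ {S S′ : List Seg} (HS : IsStrand T S) (HS′ : IsStrand T S′)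
    (i : Fin (length S)) (k : Fin (length S′)) (eS : lookup S i ≡ seg t w x) (eS′ : lookup S′ k ≡ seg t y z) where

    private
      exit : ∀ {a} → CycSucc t a w → LeavesThrough (lookup S i) a w
      exit {a} aw = subst (λ s → LeavesThrough s a w) (sym eS) (aw , refl)
      entry : ∀ {b c} → CycSucc t b c → z ≡ b → EntersThrough (lookup S′ k) b c
      entry {b} {c} bc z≡b = subst (λ s → EntersThrough s b c) (sym eS′) (bc , z≡b)
      open module Leaving {a b c} (aw : CycSucc t a w) (bc : CycSucc t b c) (z≡b : z ≡ b) =
        LeavingTile T HS HS′ Tt i k (cong tile eS) (cong tile eS′) (exit aw) (entry bc z≡b)

    triangle-no-later-common-tile : length t ≡ 3 →
      ∀ (i′ : Fin (length S)) (k′ : Fin (length S′)) → toℕ i ≤ toℕ i′ → toℕ k′ ≤ toℕ k →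
      tile (lookup S i′) ≡ tile (lookup S′ k′) → toℕ i′ ≡ toℕ i × toℕ k′ ≡ toℕ k
    triangle-no-later-common-tile t≡3 =
      separate-sides⇒no-common-tile yw wx z≡w (λ { (_ , w≡x) → CycSucc⇒≢ st r≥2 wx w≡x })
      where
      z≡w : z ≡ w
      z≡w = triangle-closes st t≡3 wx xy yz
      yw : CycSucc t y w
      yw = subst (CycSucc t y) z≡w yz

    large-tile-no-later-adjacency : 4 < length t →
      ∀ (i′ : Fin (length S)) (k′ : Fin (length S′)) → toℕ i ≤ toℕ i′ → toℕ k′ ≤ toℕ k →
      ¬ AdjacentInTile (lookup S i′) (lookup S′ k′)
    large-tile-no-later-adjacency 4<r i′ k′ i≤i′ k′≤k adj
      with CycSucc-pred {t} (proj₁ (CycSucc⇒∈ wx)) | CycSucc-succ {t} (proj₂ (CycSucc⇒∈ yz))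
    ... | a , aw | c , zc
      with separate-sides⇒no-common-tile aw zc refl
             (large-tile-different-sides 4<r a w z c (aw , refl) (zc , refl)) i′ k′ i≤i′ k′≤k (proj₁ adj)
    ... | e₁ , e₂ with toℕ-injective e₁ | toℕ-injective e₂
    ... | refl | refl with subst₂ AdjacentInTile eS eS′ adj
    ...   | _ , inj₁ y≡x  = CycSucc⇒≢ st r≥2 xy (sym y≡x)
    ...   | _ , inj₂ refl = <-irrefl (sym (3-cycle⇒triangle st r≥3 xy yz wx)) (<-trans (n<1+n 3) 4<r)

partI : ∀ {n} (T : Tiling n) → PartI T
partI T t Tt x y w z xy wx yz S S′ HS HS′ i k eS eS′ =
  (λ t≡3 → triangle-facing-segments-cross T Tt xy wx yz t≡3 ,
           λ i′ k′ i≤i′ k′≤k X → triangle-no-later-common-tile T Tt xy wx yz HS HS′ i k eS eS′ t≡3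
                                   i′ k′ i≤i′ k′≤k (proj₁ X)) ,
  quadrilateral-opposite-side T Tt xy wx yz ,
  (λ 4<r → large-tile-different-sides T Tt xy wx yz 4<r ,
           λ i′ k′ i≤i′ k′≤k X → large-tile-no-later-adjacency T Tt xy wx yz HS HS′ i k eS eS′ 4<r
                                   i′ k′ i≤i′ k′≤k (proj₁ X , SegCross⇒adjacent {T = T} (strand-seg T HS i′) (strand-seg T HS′ k′) X))

-- Part (II)

Arc⇒OnSideA : ∀ {a b z} → a < b → Arc a b z → a ≤ z × z ≤ b
Arc⇒OnSideA a<b (inj₁ refl)                        = ≤-refl , <⇒≤ a<b
Arc⇒OnSideA a<b (inj₂ (inj₁ refl))                 = <⇒≤ a<b , ≤-refl
Arc⇒OnSideA a<b (inj₂ (inj₂ (inj₁ (az , zb))))       = <⇒≤ az , <⇒≤ zb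
Arc⇒OnSideA a<b (inj₂ (inj₂ (inj₂ (inj₁ (_ , ba))))) = ⊥-elim (<-asym a<b ba)
Arc⇒OnSideA a<b (inj₂ (inj₂ (inj₂ (inj₂ (ba , _))))) = ⊥-elim (<-asym a<b ba)

Arc⇒OnSideB : ∀ {a b z} → a < b → Arc b a z → z ≤ a ⊎ b ≤ z
Arc⇒OnSideB a<b (inj₁ refl)                        = inj₂ ≤-refl
Arc⇒OnSideB a<b (inj₂ (inj₁ refl))                 = inj₁ ≤-refl
Arc⇒OnSideB a<b (inj₂ (inj₂ (inj₁ (bz , za))))       = ⊥-elim (<-asym a<b (<-trans bz za))
Arc⇒OnSideB a<b (inj₂ (inj₂ (inj₂ (inj₁ (za , _))))) = inj₁ (<⇒≤ za)
Arc⇒OnSideB a<b (inj₂ (inj₂ (inj₂ (inj₂ (_ , bz))))) = inj₂ (<⇒≤ bz)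

module TwoStrands {n : ℕ} (T : Tiling n) {S S′ : List Seg} (HS : IsStrand T S) (HS′ : IsStrand T S′) where

  -- S enters a common tile at i through the side [x , y] through which S′ leaves it at k, as in Part (I).
  record Facing (i : Fin (length S)) (k : Fin (length S′)) : Set where
    field
      {t}       : List ℕ
      {w x y z} : ℕ
      isTile : IsTile T t
      x→y    : CycSucc t x y
      w→x    : CycSucc t w x
      y→z    : CycSucc t y z
      atS    : lookup S i ≡ seg t w x
      atS′   : lookup S′ k ≡ seg t y z

  across : ∀ {i k a b} → LeavesThrough (lookup S i) a b → EntersThrough (lookup S′ k) a b →
    ∀ i₁ → toℕ i₁ ≡ suc (toℕ i) → ∀ k₁ → toℕ k ≡ suc (toℕ k₁) →
    IsDiagOf T a b × LeavesThrough (lookup S′ k₁) b a × Facing i₁ k₁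
  across {i} {k} exit entry i₁ i₁≡ k₁ k≡
    with Linked-lookup-adjacent (proj₁ (proj₂ HS)) i i₁ i₁≡ | Linked-lookup-adjacent (proj₁ (proj₂ HS′)) k₁ k k≡
  ... | _ , _ , exit₀ , entry₁ , diag | _ , _ , exit₁′ , entry₀′ , _
    with LeavesThrough-unique T (strand-seg T HS i) exit exit₀ | EntersThrough-unique T (strand-seg T HS′ k) entry entry₀′
  ... | refl , refl | refl , refl = diag , exit₁′ , facing
    where
    s₁ = lookup S i₁
    s₁′ = lookup S′ k₁
    h₁ = strand-seg T HS i₁
    h₁′ = strand-seg T HS′ k₁
    same-tile : tile s₁ ≡ tile s₁′
    same-tile = tile-unique T (proj₁ h₁) (proj₁ h₁′) (proj₁ entry₁) (proj₁ exit₁′)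
    facing : Facing i₁ k₁
    facing = record
      { isTile = proj₁ h₁
      ; x→y    = proj₁ entry₁
      ; w→x    = subst (CycSucc (tile s₁) (u s₁)) (proj₂ entry₁) (proj₂ h₁)
      ; y→z    = subst₂ (λ q r → CycSucc q r (v s₁′)) (sym same-tile) (proj₂ exit₁′) (proj₂ h₁′)
      ; atS    = cong (seg (tile s₁) (u s₁)) (proj₂ entry₁)
      ; atS′   = cong₂ (λ q r → seg q r (v s₁′)) (sym same-tile) (proj₂ exit₁′)
      }

  record Corridor (i : Fin (length S)) (k : Fin (length S′)) (i′ : Fin (length S)) (k′ : Fin (length S′)) : Set where
    field
      quadsS   : ∀ (m : Fin (length S)) → toℕ i ≤ toℕ m → toℕ m < toℕ i′ → length (tile (lookup S m)) ≡ 4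
      quadsS′  : ∀ (m : Fin (length S′)) → toℕ k′ < toℕ m → toℕ m ≤ toℕ k → length (tile (lookup S′ m)) ≡ 4
      triangle : length (tile (lookup S i′)) ≡ 3
      unique   : ∀ (i″ : Fin (length S)) (k″ : Fin (length S′)) → toℕ i ≤ toℕ i″ → toℕ k″ ≤ toℕ k →
                 AdjacentInTile (lookup S i″) (lookup S′ k″) → toℕ i″ ≡ toℕ i′ × toℕ k″ ≡ toℕ k′

  LaterMeeting : Fin (length S) → Fin (length S′) → Fin (length S) → Fin (length S′) → Set
  LaterMeeting i k i′ k′ = toℕ i ≤ toℕ i′ × toℕ k′ ≤ toℕ k × AdjacentInTile (lookup S i′) (lookup S′ k′)

  private
    lookup-toℕ : ∀ {A : Set} (xs : List A) {i j : Fin (length xs)} → toℕ i ≡ toℕ j → lookup xs i ≡ lookup xs j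
    lookup-toℕ xs e = cong (lookup xs) (toℕ-injective e)

  corridor-triangle : ∀ {i k i′ k′} (F : Facing i k) → length (Facing.t F) ≡ 3 →
    LaterMeeting i k i′ k′ → Corridor i k i′ k′
  corridor-triangle {i} {k} {i′} {k′} F t≡3 (i≤i′ , k′≤k , adj) = record
    { quadsS   = λ m i≤m m<i′ → ⊥-elim (<-irrefl refl (<-≤-trans m<i′ (subst (_≤ toℕ m) (sym i′≡i) i≤m)))
    ; quadsS′  = λ m k′<m m≤k → ⊥-elim (<-irrefl refl (<-≤-trans k′<m (subst (toℕ m ≤_) (sym k′≡k) m≤k)))
    ; triangle = trans (cong (length ∘ tile) (lookup-toℕ S i′≡i)) (trans (cong (length ∘ tile) atS) t≡3)
    ; unique   = λ i″ k″ i≤i″ k″≤k adj″ → let (e₁ , e₂) = meets-once i″ k″ i≤i″ k″≤k (proj₁ adj″)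
                                           in trans e₁ (sym i′≡i) , trans e₂ (sym k′≡k)
    }
    where
    open Facing F
    meets-once = triangle-no-later-common-tile T isTile x→y w→x y→z HS HS′ i k atS atS′ t≡3
    i′≡i = proj₁ (meets-once i′ k′ i≤i′ k′≤k (proj₁ adj))
    k′≡k = proj₂ (meets-once i′ k′ i≤i′ k′≤k (proj₁ adj))

  corridor-quadrilateral : ∀ {i k i′ k′} (F : Facing i k) → length (Facing.t F) ≡ 4 →
    (∀ {i₁ k₁} → toℕ k ≡ suc (toℕ k₁) → Facing i₁ k₁ → LaterMeeting i₁ k₁ i′ k′ → Corridor i₁ k₁ i′ k′) →
    LaterMeeting i k i′ k′ → Corridor i k i′ k′
  corridor-quadrilateral {i} {k} {i′} {k′} F t≡4 recurse (i≤i′ , k′≤k , adj) = record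
    { quadsS   = λ m i≤m m<i′ → [ (λ i<m → Corridor.quadsS beyond m (after-i i<m) m<i′)
                                    , (λ i≡m → trans (cong (length ∘ tile) (lookup-toℕ S (sym i≡m))) quad-at-i)
                                    ]′ (m≤n⇒m<n∨m≡n i≤m)
    ; quadsS′  = λ m k′<m m≤k → [ (λ m<k → Corridor.quadsS′ beyond m k′<m (before-k m<k))
                                    , (λ m≡k → trans (cong (length ∘ tile) (lookup-toℕ S′ m≡k)) quad-at-k)
                                    ]′ (m≤n⇒m<n∨m≡n m≤k)
    ; triangle = Corridor.triangle beyond
    ; unique   = λ i″ k″ i≤i″ k″≤k adj″ → let (i<i″ , k″<k) = strictly-later (i≤i″ , k″≤k , adj″)
                   in Corridor.unique beyond i″ k″ (after-i i<i″) (before-k k″<k) adj″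
    }
    where
    open Facing F
    st = IsTile.increasing isTile
    z→w : CycSucc t z w
    z→w with CycSucc-succ {t} (proj₂ (CycSucc⇒∈ y→z))
    ... | _ , z→f = subst (CycSucc t z) (quadrilateral-closes st t≡4 w→x x→y y→z z→f) z→f
    quad-at-i : length (tile (lookup S i)) ≡ 4
    quad-at-i = trans (cong (length ∘ tile) atS) t≡4
    quad-at-k : length (tile (lookup S′ k)) ≡ 4
    quad-at-k = trans (cong (length ∘ tile) atS′) t≡4
    exit : LeavesThrough (lookup S i) z w
    exit = subst (λ s → LeavesThrough s z w) (sym atS) (z→w , refl)
    entry : EntersThrough (lookup S′ k) z w
    entry = subst (λ s → EntersThrough s z w) (sym atS′) (z→w , refl)
    not-here : ∀ {i″ k″} → toℕ i″ ≡ toℕ i → toℕ k″ ≡ toℕ k → ¬ AdjacentInTile (lookup S i″) (lookup S′ k″)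
    not-here i″≡i k″≡k adj″ with subst₂ AdjacentInTile (trans (lookup-toℕ S i″≡i) atS) (trans (lookup-toℕ S′ k″≡k) atS′) adj″
    ... | _ , inj₁ y≡x = CycSucc⇒≢ st (IsTile-≥2 isTile) x→y (sym y≡x)
    ... | _ , inj₂ w≡z = CycSucc⇒≢ st (IsTile-≥2 isTile) z→w (sym w≡z)
    strictly-later : ∀ {i″ k″} → LaterMeeting i k i″ k″ → toℕ i < toℕ i″ × toℕ k″ < toℕ k
    strictly-later {i″} {k″} (i≤i″ , k″≤k , adj″)
      with LeavingTile.common-tile-later T HS HS′ isTile i k (cong tile atS) (cong tile atS′) exit entry
             i″ k″ i≤i″ k″≤k (proj₁ adj″)
    ... | inj₁ (i″≡i , k″≡k) = ⊥-elim (not-here i″≡i k″≡k adj″)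
    ... | inj₂ later = later
    i<i′ = proj₁ (strictly-later (i≤i′ , k′≤k , adj))
    k′<k = proj₂ (strictly-later (i≤i′ , k′≤k , adj))
    i₁ = proj₁ (Fin-succ i i′ i<i′)
    i₁≡ = proj₂ (Fin-succ i i′ i<i′)
    k₁ = proj₁ (Fin-pred k (≤-trans (s≤s z≤n) k′<k))
    k≡ = proj₂ (Fin-pred k (≤-trans (s≤s z≤n) k′<k))
    after-i : ∀ {m : Fin (length S)} → toℕ i < toℕ m → toℕ i₁ ≤ toℕ m
    after-i {m} = subst (_≤ toℕ m) (sym i₁≡)
    before-k : ∀ {m : Fin (length S′)} → toℕ m < toℕ k → toℕ m ≤ toℕ k₁
    before-k {m} = ≤-pred ∘ subst (toℕ m <_) k≡
    beyond : Corridor i₁ k₁ i′ k′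
    beyond = recurse k≡ (proj₂ (proj₂ (across exit entry i₁ i₁≡ k₁ k≡))) (after-i i<i′ , before-k k′<k , adj)

  corridor : ∀ fuel {i k i′ k′} → toℕ k < fuel → Facing i k → LaterMeeting i k i′ k′ → Corridor i k i′ k′
  corridor zero () _ _
  corridor (suc fuel) k<fuel F meeting with m≤n⇒m<n∨m≡n (IsTile.atLeast3 (Facing.isTile F))
  ... | inj₂ 3≡r = corridor-triangle F (sym 3≡r) meeting
  ... | inj₁ 3<r with m≤n⇒m<n∨m≡n 3<r
  ...   | inj₂ 4≡r = corridor-quadrilateral F (sym 4≡r)
                       (λ k≡ → corridor fuel (≤-pred (subst (_< suc fuel) k≡ k<fuel))) meeting
  ...   | inj₁ 4<r = ⊥-elim (large-tile-no-later-adjacency T isTile x→y w→x y→z HS HS′ _ _ atS atS′ 4<r _ _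
                              (proj₁ meeting) (proj₁ (proj₂ meeting)) (proj₂ (proj₂ meeting)))
    where open Facing F

  DoubleCrossingShape : Fin (length S) → Fin (length S′) → Fin (length S) → Fin (length S′) → Set
  DoubleCrossingShape i₁ k₁ i₂ k₂ = ∃₂ λ a b → (a , b) ∈ diags T ×
    PassesThrough S a b × PassesThrough S′ a b ×
    length (tile (lookup S i₁)) ≡ 3 × length (tile (lookup S i₂)) ≡ 3 ×
    OppositeSides a b (tile (lookup S i₁)) (tile (lookup S i₂)) ×
    QuadsBetween S i₁ i₂ × QuadsBetween S′ k₁ k₂

  module AfterMeeting (i₁ : Fin (length S)) (k₁ : Fin (length S′))
    (adj₁ : AdjacentInTile (lookup S i₁) (lookup S′ k₁)) (e : u (lookup S′ k₁) ≡ v (lookup S i₁)) where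

    private
      open Confinement T HS  renaming (after-exit⊆Arc to afterS; before-entry⊆Arc to beforeS)
      open Confinement T HS′ renaming (after-exit⊆Arc to afterS′; before-entry⊆Arc to beforeS′)
      A = lookup S i₁
      B = lookup S′ k₁
      t = tile A
      Tt = proj₁ (strand-seg T HS i₁)
      st = IsTile.increasing Tt
      r≥3 = IsTile.atLeast3 Tt
      r≥2 = IsTile-≥2 Tt
      u₀ = u A
      v₀ = v A
      w₀ = v B
      u₀→v₀ : CycSucc t u₀ v₀
      u₀→v₀ = proj₂ (strand-seg T HS i₁)
      v₀→w₀ : CycSucc t v₀ w₀
      v₀→w₀ = subst₂ (λ q r → CycSucc q r w₀) (sym (proj₁ adj₁)) e (proj₂ (strand-seg T HS′ k₁))
      p₀ = proj₁ (CycSucc-pred {t} (proj₁ (CycSucc⇒∈ u₀→v₀)))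
      p₀→u₀ : CycSucc t p₀ u₀
      p₀→u₀ = proj₂ (CycSucc-pred {t} (proj₁ (CycSucc⇒∈ u₀→v₀)))
      s₀ = proj₁ (CycSucc-succ {t} (proj₂ (CycSucc⇒∈ v₀→w₀)))
      w₀→s₀ : CycSucc t w₀ s₀
      w₀→s₀ = proj₂ (CycSucc-succ {t} (proj₂ (CycSucc⇒∈ v₀→w₀)))
      exitA : LeavesThrough A p₀ u₀
      exitA = p₀→u₀ , refl
      entryA : EntersThrough A v₀ w₀
      entryA = v₀→w₀ , refl
      exitB : LeavesThrough B u₀ v₀
      exitB = subst (λ q → CycSucc q u₀ v₀) (proj₁ adj₁) u₀→v₀ , e
      entryB : EntersThrough B w₀ s₀
      entryB = subst (λ q → CycSucc q w₀ s₀) (proj₁ adj₁) w₀→s₀ , refl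

      in-two-side-Arcs : ∀ i₂ k₂ → AdjacentInTile (lookup S i₂) (lookup S′ k₂) →
        ∀ {p q p′ q′} → CycSucc t p q → CycSucc t p′ q′ → ¬ (p ≡ p′ × q ≡ q′) →
        (∀ {z} → z ∈ tile (lookup S i₂) → Arc p q z) → (∀ {z} → z ∈ tile (lookup S′ k₂) → Arc p′ q′ z) → ⊥
      in-two-side-Arcs i₂ k₂ adj₂ c c′ ne h h′ =
        side-Arcs-share-≤1 st r≥3 c c′ ne (IsTile.increasing T₂) (IsTile-≥2 T₂) h (λ {z} z∈ → h′ (subst (z ∈_) (proj₁ adj₂) z∈))
        where T₂ = proj₁ (strand-seg T HS i₂)

      in-side-Arc : ∀ {p q} → CycSucc t p q → ¬ (∀ {z} → z ∈ t → Arc p q z)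
      in-side-Arc = tile⊈side-Arc st r≥3

      tileS : ∀ i₂ → toℕ i₂ ≡ toℕ i₁ → tile (lookup S i₂) ≡ t
      tileS i₂ e₂ = cong (tile ∘ lookup S) (toℕ-injective e₂)

      tileS′ : ∀ k₂ → toℕ k₂ ≡ toℕ k₁ → tile (lookup S′ k₂) ≡ t
      tileS′ k₂ e₂ = trans (cong (tile ∘ lookup S′) (toℕ-injective e₂)) (sym (proj₁ adj₁))

    AnotherMeeting : Fin (length S) → Fin (length S′) → Set
    AnotherMeeting i₂ k₂ = AdjacentInTile (lookup S i₂) (lookup S′ k₂) × ¬ (toℕ i₂ ≡ toℕ i₁ × toℕ k₂ ≡ toℕ k₁)

    -- Confinement rules out every relative position of a second meeting but one, and that one needs
    -- S to leave through the side through which S′ entered, which makes the tile a triangle.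
    second-meeting : ∀ i₂ k₂ → AnotherMeeting i₂ k₂ → toℕ i₁ < toℕ i₂ × toℕ k₂ < toℕ k₁ × p₀ ≡ w₀
    second-meeting i₂ k₂ (adj₂ , ne) with <-cmp (toℕ i₂) (toℕ i₁) | <-cmp (toℕ k₂) (toℕ k₁)
    ... | tri< a _ _ | tri< b _ _ = ⊥-elim (in-two-side-Arcs i₂ k₂ adj₂ v₀→w₀ w₀→s₀ (λ { (p , _) → CycSucc⇒≢ st r≥2 v₀→w₀ p })
                                      (beforeS i₁ i₂ a entryA) (beforeS′ k₁ k₂ b entryB))
    ... | tri< a _ _ | tri≈ _ b _ = ⊥-elim (in-side-Arc v₀→w₀ λ {z} z∈ →
                                      beforeS i₁ i₂ a entryA (subst (z ∈_) (sym (trans (proj₁ adj₂) (tileS′ k₂ b))) z∈))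
    ... | tri< a _ _ | tri> _ _ b = ⊥-elim (in-two-side-Arcs i₂ k₂ adj₂ v₀→w₀ u₀→v₀ (λ { (p , _) → CycSucc⇒≢ st r≥2 u₀→v₀ (sym p) })
                                      (beforeS i₁ i₂ a entryA) (afterS′ k₁ k₂ b exitB))
    ... | tri≈ _ a _ | tri< b _ _ = ⊥-elim (in-side-Arc w₀→s₀ λ {z} z∈ →
                                      beforeS′ k₁ k₂ b entryB (subst (z ∈_) (trans (sym (tileS i₂ a)) (proj₁ adj₂)) z∈))
    ... | tri≈ _ a _ | tri≈ _ b _ = ⊥-elim (ne (a , b))
    ... | tri≈ _ a _ | tri> _ _ b = ⊥-elim (in-side-Arc u₀→v₀ λ {z} z∈ →
                                      afterS′ k₁ k₂ b exitB (subst (z ∈_) (trans (sym (tileS i₂ a)) (proj₁ adj₂)) z∈))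
    ... | tri> _ _ a | tri≈ _ b _ = ⊥-elim (in-side-Arc p₀→u₀ λ {z} z∈ →
                                      afterS i₁ i₂ a exitA (subst (z ∈_) (sym (trans (proj₁ adj₂) (tileS′ k₂ b))) z∈))
    ... | tri> _ _ a | tri> _ _ b = ⊥-elim (in-two-side-Arcs i₂ k₂ adj₂ p₀→u₀ u₀→v₀ (λ { (_ , q) → CycSucc⇒≢ st r≥2 u₀→v₀ q })
                                      (afterS i₁ i₂ a exitA) (afterS′ k₁ k₂ b exitB))
    ... | tri> _ _ a | tri< b _ _ with p₀ ≟ w₀
    ...   | yes p₀≡w₀ = a , b , p₀≡w₀
    ...   | no p₀≢w₀  = ⊥-elim (in-two-side-Arcs i₂ k₂ adj₂ p₀→u₀ w₀→s₀ (λ { (p , _) → p₀≢w₀ p })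
                                  (afterS i₁ i₂ a exitA) (beforeS′ k₁ k₂ b entryB))

    -- The tile of the first meeting is a triangle [u₀ , v₀ , w₀]; both strands leave it through {w₀ , u₀}
    -- and then run along a corridor of quadrilaterals up to the second meeting.
    double-crossing : ∀ i₂ k₂ → AnotherMeeting i₂ k₂ →
      DoubleCrossingShape i₁ k₁ i₂ k₂ × (∀ i₃ k₃ → AnotherMeeting i₃ k₃ → toℕ i₃ ≡ toℕ i₂ × toℕ k₃ ≡ toℕ k₂)
    double-crossing i₂ k₂ m₂@(adj₂ , _) with second-meeting i₂ k₂ m₂
    ... | i₁<i₂ , k₂<k₁ , p₀≡w₀ = shape diag , third-is-second
      where
      w₀→u₀ : CycSucc t w₀ u₀
      w₀→u₀ = subst (λ p → CycSucc t p u₀) p₀≡w₀ p₀→u₀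
      t≡3 : length t ≡ 3
      t≡3 = 3-cycle⇒triangle st r≥3 u₀→v₀ v₀→w₀ w₀→u₀
      exitA′ : LeavesThrough A w₀ u₀
      exitA′ = w₀→u₀ , refl
      entryB′ : EntersThrough B w₀ u₀
      entryB′ = subst (λ q → CycSucc q w₀ u₀) (proj₁ adj₁) w₀→u₀ , refl
      i′ = proj₁ (Fin-succ i₁ i₂ i₁<i₂)
      i′≡ = proj₂ (Fin-succ i₁ i₂ i₁<i₂)
      k′ = proj₁ (Fin-pred k₁ (≤-trans (s≤s z≤n) k₂<k₁))
      k₁≡ = proj₂ (Fin-pred k₁ (≤-trans (s≤s z≤n) k₂<k₁))
      after-i₁ : ∀ {m : Fin (length S)} → toℕ i₁ < toℕ m → toℕ i′ ≤ toℕ m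
      after-i₁ {m} = subst (_≤ toℕ m) (sym i′≡)
      before-k₁ : ∀ {m : Fin (length S′)} → toℕ m < toℕ k₁ → toℕ m ≤ toℕ k′
      before-k₁ {m} = ≤-pred ∘ subst (toℕ m <_) k₁≡
      crossed = across exitA′ entryB′ i′ i′≡ k′ k₁≡
      diag = proj₁ crossed
      exitB′ = proj₁ (proj₂ crossed)
      C : Corridor i′ k′ i₂ k₂
      C = corridor (suc (toℕ k′)) ≤-refl (proj₂ (proj₂ crossed)) (after-i₁ i₁<i₂ , before-k₁ k₂<k₁ , adj₂)
      quadsS : QuadsBetween S i₁ i₂
      quadsS m (inj₁ (i₁<m , m<i₂)) = Corridor.quadsS C m (after-i₁ i₁<m) m<i₂
      quadsS m (inj₂ (i₂<m , m<i₁)) = ⊥-elim (<-asym i₁<i₂ (<-trans i₂<m m<i₁))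
      quadsS′ : QuadsBetween S′ k₁ k₂
      quadsS′ m (inj₁ (k₁<m , m<k₂)) = ⊥-elim (<-asym k₂<k₁ (<-trans k₁<m m<k₂))
      quadsS′ m (inj₂ (k₂<m , m<k₁)) = Corridor.quadsS′ C m k₂<m (before-k₁ m<k₁)
      t⊆ : ∀ {z} → z ∈ t → Arc u₀ w₀ z
      t⊆ = tile⊆Arc st r≥2 w₀→u₀
      beyond⊆ : ∀ {z} → z ∈ tile (lookup S i₂) → Arc w₀ u₀ z
      beyond⊆ = afterS i₁ i₂ i₁<i₂ exitA′
      shape : IsDiagOf T w₀ u₀ → DoubleCrossingShape i₁ k₁ i₂ k₂
      shape (inj₁ d∈) = w₀ , u₀ , d∈ , lose (∈-lookup i₁) (inj₁ exitA′) , lose (∈-lookup k′) (inj₂ exitB′) ,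
        t≡3 , Corridor.triangle C ,
        inj₂ (All.tabulate (Arc⇒OnSideB w<u ∘ t⊆) , All.tabulate (Arc⇒OnSideA w<u ∘ beyond⊆)) , quadsS , quadsS′
        where w<u = diag-ordered T d∈
      shape (inj₂ d∈) = u₀ , w₀ , d∈ , lose (∈-lookup i₁) (inj₂ exitA′) , lose (∈-lookup k′) (inj₁ exitB′) ,
        t≡3 , Corridor.triangle C ,
        inj₁ (All.tabulate (Arc⇒OnSideA u<w ∘ t⊆) , All.tabulate (Arc⇒OnSideB u<w ∘ beyond⊆)) , quadsS , quadsS′
        where u<w = diag-ordered T d∈
      third-is-second : ∀ i₃ k₃ → AnotherMeeting i₃ k₃ → toℕ i₃ ≡ toℕ i₂ × toℕ k₃ ≡ toℕ k₂
      third-is-second i₃ k₃ m₃ with second-meeting i₃ k₃ m₃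
      ... | i₁<i₃ , k₃<k₁ , _ = Corridor.unique C i₃ k₃ (after-i₁ i₁<i₃) (before-k₁ k₃<k₁) (proj₁ m₃)

module _ {n : ℕ} (T : Tiling n) {S S′ : List Seg} (HS : IsStrand T S) (HS′ : IsStrand T S′) where

  private
    module S→S′ = TwoStrands T HS HS′
    module S′→S = TwoStrands T HS′ HS

    adjacent : (c : Crossing S S′) → AdjacentInTile (lookup S (proj₁ (proj₁ c))) (lookup S′ (proj₂ (proj₁ c)))
    adjacent ((i , k) , X) = proj₁ X , SegCross⇒adjacent {T = T} (strand-seg T HS i) (strand-seg T HS′ k) X

    adjacent′ : (c : Crossing S S′) → AdjacentInTile (lookup S′ (proj₂ (proj₁ c))) (lookup S (proj₁ (proj₁ c)))
    adjacent′ = AdjacentInTile-sym ∘ adjacent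

    Distinct : Crossing S S′ → Crossing S S′ → Set
    Distinct ((i₁ , k₁) , _) ((i₂ , k₂) , _) = ¬ (toℕ i₂ ≡ toℕ i₁ × toℕ k₂ ≡ toℕ k₁)

    same-position : ∀ {m m′} {i i′ : Fin m} {k k′ : Fin m′} → toℕ i ≡ toℕ i′ → toℕ k ≡ toℕ k′ → (i , k) ≡ (i′ , k′)
    same-position e e′ = cong₂ _,_ (toℕ-injective e) (toℕ-injective e′)

    position-≟ : (c₁ c₂ : Crossing S S′) → proj₁ c₁ ≡ proj₁ c₂ ⊎ Distinct c₁ c₂
    position-≟ ((i₁ , k₁) , _) ((i₂ , k₂) , _) with toℕ i₂ ≟ toℕ i₁ | toℕ k₂ ≟ toℕ k₁
    ... | yes e | yes e′ = inj₁ (same-position (sym e) (sym e′))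
    ... | no ne | _      = inj₂ (ne ∘ proj₁)
    ... | yes _ | no ne  = inj₂ (ne ∘ proj₂)

    ≢⇒Distinct : (c₁ c₂ : Crossing S S′) → proj₁ c₁ ≢ proj₁ c₂ → Distinct c₁ c₂
    ≢⇒Distinct _ _ ne (e , e′) = ne (same-position (sym e) (sym e′))

    third-is-second : (c₁ c₂ c₃ : Crossing S S′) → Distinct c₁ c₂ → Distinct c₁ c₃ → proj₁ c₂ ≡ proj₁ c₃
    third-is-second c₁@((i₁ , k₁) , _) c₂@((i₂ , k₂) , _) c₃@((i₃ , k₃) , _) d₂ d₃ with proj₂ (adjacent c₁)
    ... | inj₁ e = let (e₁ , e₂) = proj₂ (S→S′.AfterMeeting.double-crossing i₁ k₁ (adjacent c₁) e
                                            i₂ k₂ (adjacent c₂ , d₂)) i₃ k₃ (adjacent c₃ , d₃)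
                   in same-position (sym e₁) (sym e₂)
    ... | inj₂ e = let (e₂ , e₁) = proj₂ (S′→S.AfterMeeting.double-crossing k₁ i₁ (adjacent′ c₁) e
                                            k₂ i₂ (adjacent′ c₂ , d₂ ∘ swap)) k₃ i₃ (adjacent′ c₃ , d₃ ∘ swap)
                   in same-position (sym e₁) (sym e₂)

  crossings-at-most-two : ∀ (c₁ c₂ c₃ : Crossing S S′) →
    proj₁ c₁ ≡ proj₁ c₂ ⊎ proj₁ c₁ ≡ proj₁ c₃ ⊎ proj₁ c₂ ≡ proj₁ c₃
  crossings-at-most-two c₁ c₂ c₃ with position-≟ c₁ c₂ | position-≟ c₁ c₃
  ... | inj₁ e  | _       = inj₁ e
  ... | inj₂ _  | inj₁ e  = inj₂ (inj₁ e)
  ... | inj₂ d₂ | inj₂ d₃ = inj₂ (inj₂ (third-is-second c₁ c₂ c₃ d₂ d₃))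

  double-crossing-shape : ∀ (c₁ c₂ : Crossing S S′) → proj₁ c₁ ≢ proj₁ c₂ →
    S→S′.DoubleCrossingShape (proj₁ (proj₁ c₁)) (proj₂ (proj₁ c₁)) (proj₁ (proj₁ c₂)) (proj₂ (proj₁ c₂))
  double-crossing-shape c₁@((i₁ , k₁) , X₁) c₂@((i₂ , k₂) , X₂) ne with proj₂ (adjacent c₁)
  ... | inj₁ e = proj₁ (S→S′.AfterMeeting.double-crossing i₁ k₁ (adjacent c₁) e
                         i₂ k₂ (adjacent c₂ , ≢⇒Distinct c₁ c₂ ne))
  ... | inj₂ e with proj₁ (S′→S.AfterMeeting.double-crossing k₁ i₁ (adjacent′ c₁) e
                             k₂ i₂ (adjacent′ c₂ , ≢⇒Distinct c₁ c₂ ne ∘ swap))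
  ...   | a , b , d∈ , passS′ , passS , tri₁ , tri₂ , opposite , quadsS′ , quadsS =
    a , b , d∈ , passS , passS′ ,
    trans (cong length (proj₁ X₁)) tri₁ , trans (cong length (proj₁ X₂)) tri₂ ,
    subst₂ (OppositeSides a b) (sym (proj₁ X₁)) (sym (proj₁ X₂)) opposite , quadsS , quadsS′

partII : ∀ {n} (T : Tiling n) → PartII T
partII T S S′ HS HS′ _ = crossings-at-most-two T HS HS′ , double-crossing-shape T HS HS′

mainTheorem7 : (n : ℕ) → 3 ≤ n → (T : Tiling n) → PartI T × PartII T
mainTheorem7 n _ T = partI T , partII T
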